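{- Let $n\ge 2$, and let $h,z$ be integers with $1\le h\le n-1$ and $1\le z\le h-1$. Then $R_n(h,z)\ge R_n(h+1,z)$ if and only if $h\le \tfrac12(n+z)$.
   Context: $P_n=C_2\times C_n$ is the poset on cells $(i,j)$, $i\in\{1,2\}$, $j\in\{1,\dots,n\}$, with $(i,j)\preceq(i',j')$ iff $i\le i'$ and $j\le j'$. A linear extension is an order-preserving bijection $L$ from the cells to $\{1,\dots,2n\}$, chosen uniformly at random. For integers $h,z$ with $1\le h-z$ and $h\le n$, define $R_n(h,z):=\mathbf P\bigl[L(2,h-z)<L(1,h)\bigr]$. -}

module Defs where

open import Data.Nat using (ℕ; zero; suc; _*_; _<_; _≤_; _∸_)
open import Data.Nat.Properties using (_<?_)
open import Data.Fin using (Fin; toℕ) renaming (zero to fzero; suc to fsuc; _≤_ to _≤ᶠ_; _≤?_ to _≤ᶠ?_)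
open import Data.Fin.Properties using (all?; any?; _≟_)
open import Data.Vec using (Vec; []; _∷_; lookup)
open import Data.List using (List; []; _∷_; concatMap; map; filter; length)
open import Data.Product using (_×_; _,_; ∃)
open import Data.Integer using (+_)
open import Data.Rational using (ℚ; _/_; 0ℚ)
open import Relation.Binary.PropositionalEquality using (_≡_)
open import Relation.Nullary using (Dec; yes; no; _×-dec_; ¬?)
open import Relation.Nullary.Decidable using (_→-dec_)

-- A labelling of the cells of P_n = C_2 × C_n (0-indexed: row r : Fin 2,
-- column c : Fin n) by labels in Fin (2n), stored as a 2 × n table.
Labelling : ℕ → Set
Labelling n = Vec (Vec (Fin (2 * n)) n) 2

val : ∀ {n} → Labelling n → Fin 2 → Fin n → Fin (2 * n)
val L r c = lookup (lookup L r) c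

OrderPreserving : ∀ {n} → Labelling n → Set
OrderPreserving {n} L = ∀ r c r′ c′ → r ≤ᶠ r′ → c ≤ᶠ c′ → val L r c ≤ᶠ val L r′ c′

Injective : ∀ {n} → Labelling n → Set
Injective {n} L = ∀ r c r′ c′ → val L r c ≡ val L r′ c′ → (r ≡ r′ × c ≡ c′)

Surjective : ∀ {n} → Labelling n → Set
Surjective {n} L = ∀ (k : Fin (2 * n)) → ∃ λ r → ∃ λ c → val L r c ≡ k

-- a linear extension: an order-preserving bijection cells → {1..2n}
-- (labels are shifted to 0..2n-1, which does not affect comparisons)
IsLinearExtension : ∀ {n} → Labelling n → Set
IsLinearExtension L = OrderPreserving L × Injective L × Surjective L

isLinearExtension? : ∀ {n} (L : Labelling n) → Dec (IsLinearExtension L)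
isLinearExtension? {n} L =
  (all? λ r → all? λ c → all? λ r′ → all? λ c′ →
     (r ≤ᶠ? r′) →-dec ((c ≤ᶠ? c′) →-dec (val L r c ≤ᶠ? val L r′ c′)))
  ×-dec
  ((all? λ r → all? λ c → all? λ r′ → all? λ c′ →
     (val L r c ≟ val L r′ c′) →-dec ((r ≟ r′) ×-dec (c ≟ c′)))
  ×-dec
  (all? λ k → any? λ r → any? λ c → val L r c ≟ k))

allFin : (m : ℕ) → List (Fin m)
allFin zero = []
allFin (suc m) = fzero ∷ map fsuc (allFin m)

allVec : (k m : ℕ) → List (Vec (Fin m) k)
allVec zero m = [] ∷ []
allVec (suc k) m = concatMap (λ x → map (x ∷_) (allVec k m)) (allFin m)

allLabellings : (n : ℕ) → List (Labelling n)
allLabellings n =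
  concatMap (λ a → map (λ b → a ∷ b ∷ []) (allVec n (2 * n))) (allVec n (2 * n))

linearExtensions : (n : ℕ) → List (Labelling n)
linearExtensions n = filter isLinearExtension? (allLabellings n)

-- label (as ℕ) of the cell in a given row at 1-indexed column j
-- (returns 0 if j is out of range; never used out of range under the hypotheses)
colℕ : ∀ {m n} → Vec (Fin m) n → ℕ → ℕ
colℕ [] _ = 0
colℕ (x ∷ xs) zero = 0
colℕ (x ∷ xs) (suc zero) = toℕ x
colℕ (x ∷ xs) (suc (suc j)) = colℕ xs (suc j)

-- rows: row 1 of the paper is index 0, row 2 is index 1
row1 row2 : Fin 2
row1 = fzero
row2 = fsuc fzero

-- the event L(2, h - z) < L(1, h)   (h - z computed in ℕ; h > z under hypotheses)
Event : ∀ n → ℕ → ℕ → Labelling n → Set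
Event n h z L = colℕ (lookup L row2) (h ∸ z) < colℕ (lookup L row1) h

event? : ∀ n h z (L : Labelling n) → Dec (Event n h z L)
event? n h z L = _ <? _

-- probability as a ratio of counts (uniform measure); 0 if the set is empty
ratio : ℕ → ℕ → ℚ
ratio a zero = 0ℚ
ratio a (suc b) = (+ a) / suc b

-- R_n(h,z) = P[ L(2,h-z) < L(1,h) ] for L a uniformly random linear extension
R : ℕ → ℕ → ℕ → ℚ
R n h z = ratio (length (filter (event? n h z) (linearExtensions n)))
                (length (linearExtensions n))

module Submission where

-- Reading the labels 1, …, 2n of a linear extension of C₂ × C_n in order and writing ↑
-- for a label in row 1 and ↓ for one in row 2 is a bijection onto the Dyck words of length 2n;
-- the cell in column j of a row carries the place of the j-th letter of that row.  Under it the
-- event L(2, h−z) < L(1, h) says that at most h − 1 of the first 2h − z − 1 letters are ↑.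
-- Moving this cut two letters on (h ↦ h + 1) loses the words passing it by ↑↑ at height z − 1
-- and gains those passing it by ↓↓ at height z + 1.  Splitting at the cut, each of these two sets
-- is counted by a product of two ballot numbers; their closed forms (from the reflection
-- principle) show that the gain is at most the loss exactly when 2h ≤ n + z.

open import Defs
open import Data.Nat using (ℕ; suc; _+_; _*_; _∸_; _≤_)
open import Data.Rational using () renaming (_≤_ to _≤ℚ_)
open import Function.Bundles using (_⇔_)

open import Data.Nat using (zero; _<_; _≤ᵇ_; _<ᵇ_; _≡ᵇ_; z≤n; s≤s; NonZero; >-nonZero)
open import Data.Nat.Properties
open import Data.Nat.Tactic.RingSolver using (solve-∀)
open import Algebra.Properties.CommutativeSemigroup +-commutativeSemigroup
  using () renaming (interchange to +-interchange)
open import Data.Bool using (Bool; true; false; not; _∧_)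
open import Data.Bool.Properties using (∧-zeroʳ; ∧-identityʳ; not-involutive)
open import Data.Fin using (Fin; toℕ; fromℕ<; _↑ˡ_) renaming (zero to fzero; suc to fsuc)
import Data.Fin.Properties as Fin
open import Data.Vec using (Vec; []; _∷_; _++_; lookup; tabulate)
import Data.Vec.Properties as Vec
open import Data.List using (List; []; _∷_; map; concatMap; filter; length)
import Data.List as List
open import Data.Maybe using (Maybe; just; nothing; _>>=_)
open import Data.Product using (_×_; _,_; proj₁; proj₂; ∃)
open import Data.Sum using (_⊎_; inj₁; inj₂)
open import Data.Empty using (⊥; ⊥-elim)
open import Function.Bundles using (mk⇔; Equivalence)
open import Function.Base using (_∘_)
open import Relation.Binary.PropositionalEquality
open import Relation.Binary.Definitions using (DecidableEquality; tri<; tri≈; tri>)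
open import Relation.Nullary using (¬_; Dec; yes; no; does)
open import Relation.Nullary.Reflects using (Reflects; ofʸ; ofⁿ; fromEquivalence)
open import Relation.Nullary.Decidable using (dec-true; dec-false)
open import Relation.Unary using (Pred; Decidable)
open import Function.Construct.Composition using (_⇔-∘_)
import Data.Integer as ℤ
import Data.Integer.Properties as ℤ
import Data.Rational.Properties as ℚ
open import Data.Rational.Unnormalised using (mkℚᵘ; *≤*)
import Data.Rational.Unnormalised.Properties as ℚᵘ

false≢true : false ≢ true
false≢true ()

𝟙 : Bool → ℕ
𝟙 true = 1
𝟙 false = 0

𝟙≤1 : ∀ b → 𝟙 b ≤ 1
𝟙≤1 true = ≤-refl
𝟙≤1 false = z≤n

𝟙-not : ∀ b → 𝟙 b + 𝟙 (not b) ≡ 1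
𝟙-not true = refl
𝟙-not false = refl

𝟙-∧-* : ∀ a b → 𝟙 (a ∧ b) ≡ 𝟙 a * 𝟙 b
𝟙-∧-* true b = sym (+-identityʳ (𝟙 b))
𝟙-∧-* false b = refl

𝟙-∧ : ∀ a b → 𝟙 (a ∧ b) ≤ 𝟙 a
𝟙-∧ true b = 𝟙≤1 b
𝟙-∧ false b = z≤n

∑ : {A : Set} → List A → (A → ℕ) → ℕ
∑ [] f = 0
∑ (x ∷ xs) f = f x + ∑ xs f

module _ {A : Set} where

  ∑-cong : (xs : List A) {f g : A → ℕ} → (∀ x → f x ≡ g x) → ∑ xs f ≡ ∑ xs g
  ∑-cong [] e = refl
  ∑-cong (x ∷ xs) e = cong₂ _+_ (e x) (∑-cong xs e)

  ∑-zero : (xs : List A) (f : A → ℕ) → (∀ x → f x ≡ 0) → ∑ xs f ≡ 0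
  ∑-zero [] f e = refl
  ∑-zero (x ∷ xs) f e rewrite e x = ∑-zero xs f e

  ∑-+ : (xs : List A) (f g : A → ℕ) → ∑ xs (λ x → f x + g x) ≡ ∑ xs f + ∑ xs g
  ∑-+ [] f g = refl
  ∑-+ (x ∷ xs) f g rewrite ∑-+ xs f g = +-interchange (f x) (g x) (∑ xs f) (∑ xs g)

  ∑-*ˡ : (xs : List A) (c : ℕ) (f : A → ℕ) → ∑ xs (λ x → c * f x) ≡ c * ∑ xs f
  ∑-*ˡ [] c f = sym (*-zeroʳ c)
  ∑-*ˡ (x ∷ xs) c f rewrite ∑-*ˡ xs c f = sym (*-distribˡ-+ c (f x) _)

  ∑-*ʳ : (xs : List A) (f : A → ℕ) (c : ℕ) → ∑ xs (λ x → f x * c) ≡ ∑ xs f * c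
  ∑-*ʳ xs f c = trans (∑-cong xs (λ x → *-comm (f x) c)) (trans (∑-*ˡ xs c f) (*-comm c _))

  ∑-mono : (xs : List A) {f g : A → ℕ} → (∀ x → f x ≤ g x) → ∑ xs f ≤ ∑ xs g
  ∑-mono [] h = z≤n
  ∑-mono (x ∷ xs) h = +-mono-≤ (h x) (∑-mono xs h)

  ∑-++ : (xs ys : List A) (f : A → ℕ) → ∑ (xs List.++ ys) f ≡ ∑ xs f + ∑ ys f
  ∑-++ [] ys f = refl
  ∑-++ (x ∷ xs) ys f rewrite ∑-++ xs ys f = sym (+-assoc (f x) _ _)

  length-filter : ∀ {p} {P : Pred A p} (P? : Decidable P) (xs : List A) →
    length (filter P? xs) ≡ ∑ xs (λ x → 𝟙 (does (P? x)))
  length-filter P? [] = refl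
  length-filter P? (x ∷ xs) with does (P? x)
  ... | false = length-filter P? xs
  ... | true = cong suc (length-filter P? xs)

  length-filter² : ∀ {p q} {P : Pred A p} {Q : Pred A q} (P? : Decidable P) (Q? : Decidable Q) (xs : List A) →
    length (filter Q? (filter P? xs)) ≡ ∑ xs (λ x → 𝟙 (does (P? x) ∧ does (Q? x)))
  length-filter² P? Q? [] = refl
  length-filter² P? Q? (x ∷ xs) with does (P? x)
  ... | false = length-filter² P? Q? xs
  ... | true with does (Q? x)
  ...   | false = length-filter² P? Q? xs
  ...   | true = cong suc (length-filter² P? Q? xs)

∑-map : ∀ {A B : Set} (h : A → B) (xs : List A) (f : B → ℕ) → ∑ (map h xs) f ≡ ∑ xs (λ x → f (h x))
∑-map h [] f = refl
∑-map h (x ∷ xs) f = cong (f (h x) +_) (∑-map h xs f)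

∑-concatMap : ∀ {A B : Set} (h : A → List B) (xs : List A) (f : B → ℕ) →
  ∑ (concatMap h xs) f ≡ ∑ xs (λ x → ∑ (h x) f)
∑-concatMap h [] f = refl
∑-concatMap h (x ∷ xs) f = trans (∑-++ (h x) (concatMap h xs) f) (cong (∑ (h x) f +_) (∑-concatMap h xs f))

∑-swap : ∀ {A B : Set} (xs : List A) (ys : List B) (F : A → B → ℕ) →
  ∑ xs (λ x → ∑ ys (F x)) ≡ ∑ ys (λ y → ∑ xs (λ x → F x y))
∑-swap [] ys F = sym (∑-zero ys _ (λ _ → refl))
∑-swap (x ∷ xs) ys F = trans (cong (∑ ys (F x) +_) (∑-swap xs ys F))
  (sym (∑-+ ys (F x) (λ y → ∑ xs (λ x′ → F x′ y))))

module _ {A : Set} (_≟ᴬ_ : DecidableEquality A) where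

  Enumerates : List A → Set
  Enumerates xs = ∀ a → ∑ xs (λ x → 𝟙 (does (x ≟ᴬ a))) ≡ 1

  ∑-point : (xs : List A) → Enumerates xs → ∀ a c → ∑ xs (λ x → c * 𝟙 (does (x ≟ᴬ a))) ≡ c
  ∑-point xs en a c = trans (∑-*ˡ xs c _) (trans (cong (c *_) (en a)) (*-identityʳ c))

  ∑-unique : (xs : List A) → Enumerates xs → (P : A → Bool) (a₀ : A) →
    P a₀ ≡ true → (∀ a → P a ≡ true → a ≡ a₀) → ∑ xs (λ x → 𝟙 (P x)) ≡ 1
  ∑-unique xs en P a₀ Pa₀ unique = trans (∑-cong xs indicator) (en a₀)
    where
    indicator : ∀ x → 𝟙 (P x) ≡ 𝟙 (does (x ≟ᴬ a₀))
    indicator x with P x in Px | x ≟ᴬ a₀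
    ... | true | yes _ = refl
    ... | false | no _ = refl
    ... | true | no x≢a₀ = ⊥-elim (x≢a₀ (unique x Px))
    ... | false | yes refl = case (trans (sym Px) Pa₀)
      where
      case : false ≡ true → _
      case ()

module _ {A B : Set} (_≟A_ : DecidableEquality A) (_≟B_ : DecidableEquality B) where

  count-bijection : (xs : List A) (ys : List B) → Enumerates _≟A_ xs → Enumerates _≟B_ ys →
    (p : A → Bool) (q : B → Bool) (f : A → B) (g : B → A) →
    (∀ a → p a ≡ true → q (f a) ≡ true) → (∀ b → q b ≡ true → p (g b) ≡ true) →
    (∀ a → p a ≡ true → g (f a) ≡ a) → (∀ b → q b ≡ true → f (g b) ≡ b) →
    ∑ xs (λ x → 𝟙 (p x)) ≡ ∑ ys (λ y → 𝟙 (q y))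
  count-bijection xs ys enA enB p q f g pq qp gf fg = begin
    ∑ xs (λ x → 𝟙 (p x))                               ≡⟨ ∑-cong xs (λ x → sym (∑-point _≟B_ ys enB (f x) (𝟙 (p x)))) ⟩
    ∑ xs (λ x → ∑ ys (λ y → 𝟙 (p x) * δB y (f x)))     ≡⟨ ∑-swap xs ys _ ⟩
    ∑ ys (λ y → ∑ xs (λ x → 𝟙 (p x) * δB y (f x)))     ≡⟨ ∑-cong ys (λ y → ∑-cong xs (λ x → graph x y)) ⟩
    ∑ ys (λ y → ∑ xs (λ x → 𝟙 (q y) * δA x (g y)))     ≡⟨ ∑-cong ys (λ y → ∑-point _≟A_ xs enA (g y) (𝟙 (q y))) ⟩
    ∑ ys (λ y → 𝟙 (q y)) ∎
    where
    open ≡-Reasoning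
    δA : A → A → ℕ
    δA x a = 𝟙 (does (x ≟A a))
    δB : B → B → ℕ
    δB y b = 𝟙 (does (y ≟B b))
    absurd : ∀ {C : Set} {b} → b ≡ false → b ≡ true → C
    absurd b≡false b≡true = ⊥-elim (false≢true (trans (sym b≡false) b≡true))
    -- the graphs of f on {p} and of g on {q} coincide
    graph : ∀ x y → 𝟙 (p x) * δB y (f x) ≡ 𝟙 (q y) * δA x (g y)
    graph x y with p x in px | y ≟B f x | q y in qy | x ≟A g y
    ... | true | yes refl | true | yes _ = refl
    ... | true | yes refl | true | no ne = ⊥-elim (ne (sym (gf x px)))
    ... | true | yes refl | false | _ = absurd qy (pq x px)
    ... | true | no _ | false | _ = refl
    ... | true | no _ | true | no _ = refl
    ... | true | no ne | true | yes refl = ⊥-elim (ne (sym (fg y qy)))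
    ... | false | _ | false | _ = refl
    ... | false | _ | true | no _ = refl
    ... | false | _ | true | yes refl = absurd px (qp y qy)

allFin-enumerates : ∀ m → Enumerates Fin._≟_ (allFin m)
allFin-enumerates (suc m) fzero = cong suc (trans (∑-map fsuc (allFin m) _) (∑-zero (allFin m) _ (λ _ → refl)))
allFin-enumerates (suc m) (fsuc i) = trans (∑-map fsuc (allFin m) _) (allFin-enumerates m i)

pairs-enumerate : ∀ {X Y Z : Set} (_≟X_ : DecidableEquality X) (_≟Y_ : DecidableEquality Y)
  (_≟Z_ : DecidableEquality Z) (c : X → Y → Z) (xs : List X) (ys : List Y) →
  Enumerates _≟X_ xs → Enumerates _≟Y_ ys → ∀ x₀ y₀ →
  (∀ x y → 𝟙 (does (c x y ≟Z c x₀ y₀)) ≡ 𝟙 (does (x ≟X x₀)) * 𝟙 (does (y ≟Y y₀))) →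
  ∑ (concatMap (λ x → map (c x) ys) xs) (λ z → 𝟙 (does (z ≟Z c x₀ y₀))) ≡ 1
pairs-enumerate _≟X_ _≟Y_ _≟Z_ c xs ys enX enY x₀ y₀ factor = begin
  ∑ (concatMap (λ x → map (c x) ys) xs) (λ z → 𝟙 (does (z ≟Z c x₀ y₀)))
    ≡⟨ ∑-concatMap _ xs _ ⟩
  ∑ xs (λ x → ∑ (map (c x) ys) (λ z → 𝟙 (does (z ≟Z c x₀ y₀))))
    ≡⟨ ∑-cong xs (λ x → trans (∑-map (c x) ys _) (∑-cong ys (factor x))) ⟩
  ∑ xs (λ x → ∑ ys (λ y → 𝟙 (does (x ≟X x₀)) * 𝟙 (does (y ≟Y y₀))))
    ≡⟨ ∑-cong xs (λ x → ∑-point _≟Y_ ys enY y₀ _) ⟩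
  ∑ xs (λ x → 𝟙 (does (x ≟X x₀)))
    ≡⟨ enX x₀ ⟩
  1 ∎
  where open ≡-Reasoning

_≟ᵛ_ : ∀ {k m} → DecidableEquality (Vec (Fin m) k)
_≟ᵛ_ = Vec.≡-dec Fin._≟_

_≟ᴸ_ : ∀ {n} → DecidableEquality (Labelling n)
_≟ᴸ_ = Vec.≡-dec _≟ᵛ_

allVec-enumerates : ∀ k m → Enumerates _≟ᵛ_ (allVec k m)
allVec-enumerates zero m [] = refl
allVec-enumerates (suc k) m (y ∷ v) =
  pairs-enumerate Fin._≟_ _≟ᵛ_ _≟ᵛ_ _∷_ (allFin m) (allVec k m) (allFin-enumerates m) (allVec-enumerates k m) y v
    (λ x w → 𝟙-∧-* (does (x Fin.≟ y)) (does (w ≟ᵛ v)))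

allLabellings-enumerate : ∀ n → Enumerates _≟ᴸ_ (allLabellings n)
allLabellings-enumerate n (a ∷ b ∷ []) =
  pairs-enumerate _≟ᵛ_ _≟ᵛ_ _≟ᴸ_ (λ x y → x ∷ y ∷ []) (allVec n (2 * n)) (allVec n (2 * n))
    (allVec-enumerates n (2 * n)) (allVec-enumerates n (2 * n)) a b
    (λ x y → trans (cong (λ t → 𝟙 (does (x ≟ᵛ a) ∧ t)) (∧-identityʳ _)) (𝟙-∧-* (does (x ≟ᵛ a)) (does (y ≟ᵛ b))))

-- Binomial coefficients, defined by Pascal's rule: the counting arguments below only ever use
-- this recursion (the library's _C_ is defined through factorials instead).
binom : ℕ → ℕ → ℕ
binom _ zero = 1
binom zero (suc k) = 0
binom (suc n) (suc k) = binom n k + binom n (suc k)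

binom-vanishes : ∀ n k → n < k → binom n k ≡ 0
binom-vanishes zero (suc k) _ = refl
binom-vanishes (suc n) (suc k) (s≤s n<k)
  rewrite binom-vanishes n k n<k | binom-vanishes n (suc k) (m≤n⇒m≤1+n n<k) = refl

binom-diag : ∀ n → binom n n ≡ 1
binom-diag zero = refl
binom-diag (suc n) rewrite binom-diag n | binom-vanishes n (suc n) ≤-refl = refl

binom-pos : ∀ n k → k ≤ n → 0 < binom n k
binom-pos n zero _ = s≤s z≤n
binom-pos (suc n) (suc k) (s≤s k≤n) = ≤-trans (binom-pos n k k≤n) (m≤m+n _ _)

binom-one : ∀ n → binom n 1 ≡ n
binom-one zero = refl
binom-one (suc n) = cong suc (binom-one n)

binom-absorb : ∀ L j → binom L (suc j) * suc j + binom L j * j ≡ binom L j * L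
binom-absorb zero zero = refl
binom-absorb zero (suc j) = refl
binom-absorb (suc L) zero rewrite binom-one L = cong (λ x → suc (x + 0)) (*-identityʳ L)
binom-absorb (suc L) (suc j) =
  step (binom L j) (binom L (suc j)) (binom L (suc (suc j))) (binom-absorb L (suc j)) (binom-absorb L j)
  where
  step : ∀ x y w → w * suc (suc j) + y * suc j ≡ y * L → y * suc j + x * j ≡ x * L →
     (y + w) * suc (suc j) + (x + y) * suc j ≡ (x + y) * suc L
  step x y w e₁ e₂ = begin
    (y + w) * suc (suc j) + (x + y) * suc j                      ≡⟨ regroup x y w j ⟩
    (w * suc (suc j) + y * suc j) + y + (y * suc j + x * j) + x ≡⟨ cong₂ (λ a b → a + y + b + x) e₁ e₂ ⟩
    y * L + y + x * L + x                                        ≡⟨ collect x y L ⟩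
    (x + y) * suc L ∎
    where
    open ≡-Reasoning
    regroup : ∀ x y w j → (y + w) * suc (suc j) + (x + y) * suc j ≡
      (w * suc (suc j) + y * suc j) + y + (y * suc j + x * j) + x
    regroup = solve-∀
    collect : ∀ x y L → y * L + y + x * L + x ≡ (x + y) * suc L
    collect = solve-∀

binom-succ : ∀ j e → binom (j + e) (suc j) * suc j ≡ binom (j + e) j * e
binom-succ j e = +-cancelʳ-≡ (binom (j + e) j * j) _ _ (begin
  binom (j + e) (suc j) * suc j + binom (j + e) j * j   ≡⟨ binom-absorb (j + e) j ⟩
  binom (j + e) j * (j + e)                            ≡⟨ *-distribˡ-+ (binom (j + e) j) j e ⟩
  binom (j + e) j * j + binom (j + e) j * e            ≡⟨ +-comm (binom (j + e) j * j) _ ⟩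
  binom (j + e) j * e + binom (j + e) j * j ∎)
  where open ≡-Reasoning

binom-sym : ∀ a b → binom (a + b) a ≡ binom (a + b) b
binom-sym zero b = sym (binom-diag b)
binom-sym (suc a) zero rewrite +-identityʳ a = binom-diag (suc a)
binom-sym (suc a) (suc b) = begin
  binom (a + suc b) a + binom (a + suc b) (suc a) ≡⟨ cong₂ _+_ (binom-sym a (suc b)) (cong (λ t → binom t (suc a)) (+-suc a b)) ⟩
  binom (a + suc b) (suc b) + binom (suc a + b) (suc a) ≡⟨ cong (binom (a + suc b) (suc b) +_) (binom-sym (suc a) b) ⟩
  binom (a + suc b) (suc b) + binom (suc a + b) b ≡⟨ cong (λ t → binom (a + suc b) (suc b) + binom t b) (sym (+-suc a b)) ⟩
  binom (a + suc b) (suc b) + binom (a + suc b) b ≡⟨ +-comm (binom (a + suc b) (suc b)) (binom (a + suc b) b) ⟩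
  binom (suc a + suc b) (suc b) ∎
  where open ≡-Reasoning

-- ballot d u v : the number of lattice paths that start at height d, take u up-steps and
-- v down-steps, and never go below height 0 (first step: up if possible, then down).
ballot : ℕ → ℕ → ℕ → ℕ
ballot d zero zero = 1
ballot d (suc u) zero = ballot (suc d) u zero
ballot zero zero (suc v) = 0
ballot (suc d) zero (suc v) = ballot d zero v
ballot zero (suc u) (suc v) = ballot 1 u (suc v)
ballot (suc d) (suc u) (suc v) = ballot (suc (suc d)) u (suc v) + ballot d (suc u) v

ballot-no-downs : ∀ d u → ballot d u 0 ≡ 1
ballot-no-downs d zero = refl
ballot-no-downs d (suc u) = ballot-no-downs (suc d) u

ballot-no-ups : ∀ d v → v ≤ d → ballot d 0 v ≡ 1
ballot-no-ups d zero _ = refl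
ballot-no-ups (suc d) (suc v) (s≤s v≤d) = ballot-no-ups d v v≤d

-- reflected L d v : C(L, v-d-1) if v > d, and 0 otherwise.  By the reflection principle this
-- is the number of paths of length L from height d with v down-steps that do go below 0.
reflected : ℕ → ℕ → ℕ → ℕ
reflected L zero zero = 0
reflected L zero (suc v) = binom L v
reflected L (suc d) zero = 0
reflected L (suc d) (suc v) = reflected L d v

reflected-vanishes : ∀ L d v → v ≤ d → reflected L d v ≡ 0
reflected-vanishes L zero zero _ = refl
reflected-vanishes L (suc d) zero _ = refl
reflected-vanishes L (suc d) (suc v) (s≤s v≤d) = reflected-vanishes L d v v≤d

reflected-pascal : ∀ L d v → reflected (suc L) d v ≡ reflected L (suc d) v + reflected L d v
reflected-pascal L zero zero = refl
reflected-pascal L zero (suc zero) = refl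
reflected-pascal L zero (suc (suc v)) = refl
reflected-pascal L (suc d) zero = refl
reflected-pascal L (suc d) (suc v) = reflected-pascal L d v

reflected-shift : ∀ L e u → reflected L e (e + u) ≡ reflected L 0 u
reflected-shift L zero u = refl
reflected-shift L (suc e) zero = reflected-vanishes L e (e + 0) (≤-reflexive (+-identityʳ e))
reflected-shift L (suc e) (suc u) = reflected-shift L e (suc u)

-- The reflection principle: good paths plus reflected bad paths are all C(u+v, v) paths.
ballot-reflection : ∀ d u v → v ≤ d + u → ballot d u v + reflected (u + v) d v ≡ binom (u + v) v
ballot-reflection d u zero _ = cong₂ _+_ (ballot-no-downs d u) (reflected-vanishes (u + 0) d 0 z≤n)
ballot-reflection zero zero (suc v) ()
ballot-reflection (suc d) zero (suc v) (s≤s v≤d) =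
  trans (cong₂ _+_ (ballot-no-ups d v v≤d′) (reflected-vanishes (suc v) d v v≤d′)) (sym (binom-diag (suc v)))
  where
  v≤d′ : v ≤ d
  v≤d′ = subst (v ≤_) (+-identityʳ d) v≤d
ballot-reflection zero (suc u) (suc v) (s≤s v≤u) = begin
  ballot 1 u (suc v) + binom (suc X) v                       ≡⟨ cong (ballot 1 u (suc v) +_) (reflected-pascal X 0 (suc v)) ⟩
  ballot 1 u (suc v) + (reflected X 1 (suc v) + binom X v)   ≡⟨ sym (+-assoc (ballot 1 u (suc v)) _ _) ⟩
  (ballot 1 u (suc v) + reflected X 1 (suc v)) + binom X v   ≡⟨ cong (_+ binom X v) (ballot-reflection 1 u (suc v) (s≤s v≤u)) ⟩
  binom X (suc v) + binom X v                                ≡⟨ +-comm (binom X (suc v)) (binom X v) ⟩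
  binom (suc X) (suc v) ∎
  where
  open ≡-Reasoning
  X = u + suc v
ballot-reflection (suc d) (suc u) (suc v) (s≤s v≤d+1+u) = begin
  (up + down) + reflected (suc X) d v                       ≡⟨ cong ((up + down) +_) (reflected-pascal X d v) ⟩
  (up + down) + (reflected X (suc d) v + reflected X d v)   ≡⟨ +-interchange up down _ _ ⟩
  (up + reflected X (suc d) v) + (down + reflected X d v)   ≡⟨ cong₂ _+_ afterUp afterDown ⟩
  binom X (suc v) + binom X v                               ≡⟨ +-comm (binom X (suc v)) (binom X v) ⟩
  binom (suc X) (suc v) ∎
  where
  open ≡-Reasoning
  X = u + suc v
  up = ballot (suc (suc d)) u (suc v)
  down = ballot d (suc u) v
  afterUp : up + reflected X (suc d) v ≡ binom X (suc v)
  afterUp = ballot-reflection (suc (suc d)) u (suc v) (subst (suc v ≤_) (cong suc (+-suc d u)) (s≤s v≤d+1+u))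
  afterDown : down + reflected X d v ≡ binom X v
  afterDown = subst (λ t → down + reflected t d v ≡ binom t v) (sym (+-suc u v)) (ballot-reflection d (suc u) v v≤d+1+u)

ballot-formula-algebra : ∀ W γ β b e → W + γ ≡ β → β * suc b + γ * b ≡ γ * (suc b + e + suc b) →
  suc (suc b + e) * W ≡ suc e * β
ballot-formula-algebra W γ β b e reflection absorption = +-cancelʳ-≡ (β * suc b + γ * b) _ _ (begin
  suc (suc b + e) * W + (β * suc b + γ * b)       ≡⟨ cong (suc (suc b + e) * W +_) absorption ⟩
  suc (suc b + e) * W + γ * (suc b + e + suc b)   ≡⟨ expand W γ b e ⟩
  suc (suc b + e) * (W + γ) + γ * b               ≡⟨ cong (λ t → suc (suc b + e) * t + γ * b) reflection ⟩
  suc (suc b + e) * β + γ * b                     ≡⟨ regroup β γ b e ⟩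
  suc e * β + (β * suc b + γ * b) ∎)
  where
  open ≡-Reasoning
  expand : ∀ W γ b e → suc (suc b + e) * W + γ * (suc b + e + suc b) ≡ suc (suc b + e) * (W + γ) + γ * b
  expand = solve-∀
  regroup : ∀ β γ b e → suc (suc b + e) * β + γ * b ≡ suc e * β + (β * suc b + γ * b)
  regroup = solve-∀

ballot-from-ground : ∀ b e → suc (b + e) * ballot 0 (b + e) b ≡ suc e * binom ((b + e) + b) b
ballot-from-ground zero e =
  cong (suc e *_) (trans (sym (+-identityʳ _)) (ballot-reflection 0 e 0 z≤n))
ballot-from-ground (suc b) e =
  ballot-formula-algebra (ballot 0 (suc b + e) (suc b)) (binom L b) (binom L (suc b)) b e
    (ballot-reflection 0 (suc b + e) (suc b) (s≤s (m≤m+n b e))) (binom-absorb L b)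
  where
  L = (suc b + e) + suc b

ballot-to-ground : ∀ u e → suc (u + e) * ballot e u (u + e) ≡ suc e * binom (u + (u + e)) u
ballot-to-ground zero e = cong (suc e *_) (begin
  ballot e 0 e                           ≡⟨ sym (+-identityʳ _) ⟩
  ballot e 0 e + 0                       ≡⟨ cong (ballot e 0 e +_) (sym (reflected-vanishes e e e ≤-refl)) ⟩
  ballot e 0 e + reflected e e e         ≡⟨ ballot-reflection e 0 e (m≤m+n e 0) ⟩
  binom e e                              ≡⟨ binom-diag e ⟩
  1 ∎)
  where open ≡-Reasoning
ballot-to-ground (suc u) e =
  ballot-formula-algebra (ballot e (suc u) (suc u + e)) (binom L u) (binom L (suc u)) u e reflection
    (trans (binom-absorb L u) (cong (binom L u *_) (+-comm (suc u) (suc u + e))))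
  where
  L = suc u + (suc u + e)
  W = ballot e (suc u) (suc u + e)
  reflection : W + binom L u ≡ binom L (suc u)
  reflection = begin
    W + binom L u                     ≡⟨ cong (W +_) (sym (reflected-shift L e (suc u))) ⟩
    W + reflected L e (e + suc u)     ≡⟨ cong (λ t → W + reflected L e t) (+-comm e (suc u)) ⟩
    W + reflected L e (suc u + e)     ≡⟨ ballot-reflection e (suc u) (suc u + e) (≤-reflexive (+-comm (suc u) e)) ⟩
    binom L (suc u + e)               ≡⟨ sym (binom-sym (suc u) (suc u + e)) ⟩
    binom L (suc u) ∎
    where open ≡-Reasoning

reflects-true : ∀ {P : Set} {b} → Reflects P b → P → b ≡ true
reflects-true (ofʸ _) _ = refl
reflects-true (ofⁿ ¬p) p = ⊥-elim (¬p p)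

reflects-false : ∀ {P : Set} {b} → Reflects P b → ¬ P → b ≡ false
reflects-false (ofʸ p) ¬p = ⊥-elim (¬p p)
reflects-false (ofⁿ _) _ = refl

reflects-sound : ∀ {P : Set} {b} → Reflects P b → b ≡ true → P
reflects-sound (ofʸ p) _ = p

≡ᵇ-reflects-≡ : ∀ m n → Reflects (m ≡ n) (m ≡ᵇ n)
≡ᵇ-reflects-≡ m n = fromEquivalence (≡ᵇ⇒≡ m n) (≡⇒≡ᵇ m n)

double-injective : ∀ a b → a + a ≡ b + b → a ≡ b
double-injective a b a+a≡b+b with <-cmp a b
... | tri≈ _ a≡b _ = a≡b
... | tri< a<b _ _ = ⊥-elim (<-irrefl a+a≡b+b (+-mono-< a<b a<b))
... | tri> _ _ b<a = ⊥-elim (<-irrefl (sym a+a≡b+b) (+-mono-< b<a b<a))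

prefixCount : (ℕ → Bool) → ℕ → ℕ
prefixCount φ zero = 0
prefixCount φ (suc q) = prefixCount φ q + 𝟙 (φ q)

prefixCount-cons : ∀ φ q → prefixCount φ (suc q) ≡ 𝟙 (φ 0) + prefixCount (λ ℓ → φ (suc ℓ)) q
prefixCount-cons φ zero = +-comm 0 (𝟙 (φ 0))
prefixCount-cons φ (suc q) = trans (cong (_+ 𝟙 (φ (suc q))) (prefixCount-cons φ q)) (+-assoc (𝟙 (φ 0)) _ _)

prefixCount-cong : ∀ φ ψ q → (∀ ℓ → ℓ < q → φ ℓ ≡ ψ ℓ) → prefixCount φ q ≡ prefixCount ψ q
prefixCount-cong φ ψ zero e = refl
prefixCount-cong φ ψ (suc q) e =
  cong₂ _+_ (prefixCount-cong φ ψ q (λ ℓ l → e ℓ (m≤n⇒m≤1+n l))) (cong 𝟙 (e q ≤-refl))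

prefixCount-split : ∀ φ q → prefixCount φ q + prefixCount (not ∘ φ) q ≡ q
prefixCount-split φ zero = refl
prefixCount-split φ (suc q) = begin
  prefixCount φ q + 𝟙 (φ q) + (prefixCount (not ∘ φ) q + 𝟙 (not (φ q)))
    ≡⟨ +-interchange (prefixCount φ q) (𝟙 (φ q)) (prefixCount (not ∘ φ) q) _ ⟩
  (prefixCount φ q + prefixCount (not ∘ φ) q) + (𝟙 (φ q) + 𝟙 (not (φ q)))
    ≡⟨ cong₂ _+_ (prefixCount-split φ q) (𝟙-not (φ q)) ⟩
  q + 1
    ≡⟨ +-comm q 1 ⟩
  suc q ∎
  where open ≡-Reasoning

prefixCount-mono : ∀ φ {q q′} → q ≤ q′ → prefixCount φ q ≤ prefixCount φ q′
prefixCount-mono φ {q} {zero} z≤n = ≤-refl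
prefixCount-mono φ {q} {suc q′} q≤ with m≤n⇒m<n∨m≡n q≤
... | inj₂ refl = ≤-refl
... | inj₁ (s≤s q≤q′) = ≤-trans (prefixCount-mono φ q≤q′) (m≤m+n _ _)

-- position φ j N : the place of the (j+1)-th ℓ < N with φ ℓ, or N if there is none;
-- it counts the ℓ < N before which fewer than j + 1 such places occur.
position : (ℕ → Bool) → ℕ → ℕ → ℕ
position φ j zero = 0
position φ j (suc N) = position φ j N + 𝟙 (prefixCount φ (suc N) ≤ᵇ j)

position≤ : ∀ φ j N → position φ j N ≤ N
position≤ φ j zero = z≤n
position≤ φ j (suc N) =
  ≤-trans (+-monoʳ-≤ (position φ j N) (𝟙≤1 _)) (≤-trans (+-monoˡ-≤ 1 (position≤ φ j N)) (≤-reflexive (+-comm N 1)))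

module _ (φ : ℕ → Bool) where

  position-galois : ∀ j N ℓ → ℓ ≤ N → (position φ j N < ℓ → j < prefixCount φ ℓ) × (j < prefixCount φ ℓ → position φ j N < ℓ)
  position-galois j zero zero z≤n = (λ ()) , (λ ())
  position-galois j (suc N) ℓ ℓ≤ with prefixCount φ (suc N) ≤ᵇ j in eb | m≤n⇒m<n∨m≡n ℓ≤
  ... | true | inj₁ (s≤s ℓ≤N) =
    (λ p → proj₁ (position-galois j N ℓ ℓ≤N) (<-trans (m<m+n (position φ j N) (s≤s z≤n)) p)) ,
    (λ q → ⊥-elim (<⇒≱ q (≤-trans (prefixCount-mono φ (m≤n⇒m≤1+n ℓ≤N)) (reflects-sound (≤ᵇ-reflects-≤ _ _) eb))))
  ... | false | inj₁ (s≤s ℓ≤N) =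
    (λ p → proj₁ (position-galois j N ℓ ℓ≤N) (subst (_< ℓ) (+-identityʳ _) p)) ,
    (λ q → subst (_< ℓ) (sym (+-identityʳ _)) (proj₂ (position-galois j N ℓ ℓ≤N) q))
  ... | true | inj₂ refl =
    (λ p → ⊥-elim (<⇒≱ p (subst (suc N ≤_) (+-comm 1 (position φ j N)) (s≤s N≤position)))) ,
    (λ q → ⊥-elim (<⇒≱ q (reflects-sound (≤ᵇ-reflects-≤ _ _) eb)))
    where
    N≤position : N ≤ position φ j N
    N≤position = ≮⇒≥ (λ p → <⇒≱ (proj₁ (position-galois j N N ≤-refl) p)
      (≤-trans (prefixCount-mono φ (n≤1+n N)) (reflects-sound (≤ᵇ-reflects-≤ _ _) eb)))
  ... | false | inj₂ refl =
    (λ _ → ≰⇒> (λ le → false≢true (trans (sym eb) (reflects-true (≤ᵇ-reflects-≤ _ _) le)))) ,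
    (λ _ → s≤s (subst (_≤ N) (sym (+-identityʳ _)) (position≤ φ j N)))

  position-spec : ∀ j N → position φ j N < N → (prefixCount φ (position φ j N) ≡ j) × (φ (position φ j N) ≡ true)
  position-spec j N p<N = ≤-antisym count≤j j≤count , holds
    where
    P = position φ j N
    count≤j : prefixCount φ P ≤ j
    count≤j = ≮⇒≥ (λ q → <-irrefl refl (proj₂ (position-galois j N P (<⇒≤ p<N)) q))
    j<next : j < prefixCount φ P + 𝟙 (φ P)
    j<next = proj₁ (position-galois j N (suc P) p<N) ≤-refl
    holds : φ P ≡ true
    holds with φ P in eφ
    ... | true = refl
    ... | false = ⊥-elim (<⇒≱ j<next (subst (_≤ j) (sym (trans (cong (λ b → prefixCount φ P + 𝟙 b) eφ) (+-identityʳ _))) count≤j))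
    j≤count : j ≤ prefixCount φ P
    j≤count = ≤-pred (subst (j <_) (trans (cong (λ b → prefixCount φ P + 𝟙 b) holds) (+-comm (prefixCount φ P) 1)) j<next)

  position-unique : ∀ j N ℓ → ℓ < N → φ ℓ ≡ true → prefixCount φ ℓ ≡ j → position φ j N ≡ ℓ
  position-unique j N ℓ ℓ<N φℓ count = ≤-antisym (≤-pred below) (≮⇒≥ notBelow)
    where
    below : position φ j N < suc ℓ
    below = proj₂ (position-galois j N (suc ℓ) ℓ<N)
      (subst (j <_) (sym (trans (cong₂ _+_ count (cong 𝟙 φℓ)) (+-comm j 1))) ≤-refl)
    notBelow : ¬ (position φ j N < ℓ)
    notBelow p = <-irrefl (sym count) (proj₁ (position-galois j N ℓ (<⇒≤ ℓ<N)) p)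

  position-mono : ∀ N {j j′} → j ≤ j′ → position φ j N ≤ position φ j′ N
  position-mono N {j} {j′} j≤j′ with m≤n⇒m<n∨m≡n (position≤ φ j′ N)
  ... | inj₂ e = subst (position φ j N ≤_) (sym e) (position≤ φ j N)
  ... | inj₁ lt = ≤-pred (proj₂ (position-galois j N (suc (position φ j′ N)) lt)
    (<-≤-trans (s≤s j≤j′) (proj₁ (position-galois j′ N (suc (position φ j′ N)) lt) ≤-refl)))

  position-strict : ∀ N {j j′} → j < j′ → position φ j′ N < N → position φ j N < position φ j′ N
  position-strict N {j} {j′} j<j′ p<N = proj₂ (position-galois j N (position φ j′ N) (<⇒≤ p<N))
    (subst (j <_) (sym (proj₁ (position-spec j′ N p<N))) j<j′)

  position<N : ∀ j N → j < prefixCount φ N → position φ j N < N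
  position<N j N = proj₂ (position-galois j N N ≤-refl)

-- Words over the two letters ↑ = fzero and ↓ = fsuc fzero; read as lattice paths, ↑ is a step up.
Word : ℕ → Set
Word L = Vec (Fin 2) L

isUp : Fin 2 → Bool
isUp fzero = true
isUp (fsuc _) = false

-- upAt w ℓ : whether the letter at place ℓ of w is ↑ (false beyond the end of w).
upAt : ∀ {L} → Word L → ℕ → Bool
upAt [] _ = false
upAt (x ∷ w) zero = isUp x
upAt (x ∷ w) (suc ℓ) = upAt w ℓ

ups downs : ∀ {L} → Word L → ℕ → ℕ
ups w = prefixCount (upAt w)
downs w = prefixCount (not ∘ upAt w)

ups-cons : ∀ {L} x (w : Word L) q → ups (x ∷ w) (suc q) ≡ 𝟙 (isUp x) + ups w q
ups-cons x w = prefixCount-cons (upAt (x ∷ w))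

downs-cons : ∀ {L} x (w : Word L) q → downs (x ∷ w) (suc q) ≡ 𝟙 (not (isUp x)) + downs w q
downs-cons x w = prefixCount-cons (not ∘ upAt (x ∷ w))

ups≤length : ∀ {L} (w : Word L) → ups w L ≤ L
ups≤length {L} w = subst (ups w L ≤_) (prefixCount-split (upAt w) L) (m≤m+n _ _)

downs≤length : ∀ {L} (w : Word L) → downs w L ≤ L
downs≤length {L} w = subst (downs w L ≤_) (prefixCount-split (upAt w) L) (m≤n+m _ _)

upAt-++ˡ : ∀ {p L} (u : Word p) (r : Word L) ℓ → ℓ < p → upAt (u ++ r) ℓ ≡ upAt u ℓ
upAt-++ˡ (x ∷ u) r zero _ = refl
upAt-++ˡ (x ∷ u) r (suc ℓ) (s≤s ℓ<p) = upAt-++ˡ u r ℓ ℓ<p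

upAt-++ʳ : ∀ {p L} (u : Word p) (r : Word L) ℓ → upAt (u ++ r) (p + ℓ) ≡ upAt r ℓ
upAt-++ʳ [] r ℓ = refl
upAt-++ʳ (x ∷ u) r ℓ = upAt-++ʳ u r ℓ

ups-++ : ∀ {p L} (u : Word p) (r : Word L) → ups (u ++ r) p ≡ ups u p
ups-++ {p} u r = prefixCount-cong _ _ p (upAt-++ˡ u r)

walk : ∀ {L} → ℕ → Word L → Maybe ℕ
walk d [] = just d
walk d (fzero ∷ w) = walk (suc d) w
walk zero (fsuc _ ∷ w) = nothing
walk (suc d) (fsuc _ ∷ w) = walk d w

endsAt : Maybe ℕ → ℕ → Bool
endsAt nothing e = false
endsAt (just x) e = x ≡ᵇ e

walk-++ : ∀ {p L} d (u : Word p) (r : Word L) → walk d (u ++ r) ≡ (walk d u >>= λ e → walk e r)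
walk-++ d [] r = refl
walk-++ d (fzero ∷ u) r = walk-++ (suc d) u r
walk-++ zero (fsuc _ ∷ u) r = refl
walk-++ (suc d) (fsuc _ ∷ u) r = walk-++ d u r

StaysAbove : ∀ {L} → ℕ → Word L → Set
StaysAbove {L} d w = ∀ q → q ≤ L → downs w q ≤ d + ups w q

walk-sound : ∀ {L} d e (w : Word L) → endsAt (walk d w) e ≡ true → StaysAbove d w × (e + downs w L ≡ d + ups w L)
walk-sound d e [] arrives = (λ { zero _ → z≤n }) , cong (_+ 0) (sym (reflects-sound (≡ᵇ-reflects-≡ d e) arrives))
walk-sound {suc L} d e (fzero ∷ w) arrives = above , balance
  where
  ih = walk-sound (suc d) e w arrives
  above : StaysAbove d (fzero ∷ w)
  above zero _ = z≤n
  above (suc q) (s≤s q≤L) = subst₂ _≤_ (sym (downs-cons fzero w q))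
    (trans (sym (+-suc d (ups w q))) (cong (d +_) (sym (ups-cons fzero w q)))) (proj₁ ih q q≤L)
  balance : e + downs (fzero ∷ w) (suc L) ≡ d + ups (fzero ∷ w) (suc L)
  balance = trans (cong (e +_) (downs-cons fzero w L))
    (trans (proj₂ ih) (trans (sym (+-suc d (ups w L))) (cong (d +_) (sym (ups-cons fzero w L)))))
walk-sound {suc L} zero e (fsuc x ∷ w) ()
walk-sound {suc L} (suc d) e (fsuc x ∷ w) arrives = above , balance
  where
  ih = walk-sound d e w arrives
  above : StaysAbove (suc d) (fsuc x ∷ w)
  above zero _ = z≤n
  above (suc q) (s≤s q≤L) = subst₂ _≤_ (sym (downs-cons (fsuc x) w q))
    (cong (suc d +_) (sym (ups-cons (fsuc x) w q))) (s≤s (proj₁ ih q q≤L))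
  balance : e + downs (fsuc x ∷ w) (suc L) ≡ suc d + ups (fsuc x ∷ w) (suc L)
  balance = trans (cong (e +_) (downs-cons (fsuc x) w L))
    (trans (+-suc e _) (trans (cong suc (proj₂ ih)) (cong (suc d +_) (sym (ups-cons (fsuc x) w L)))))

walk-complete : ∀ {L} d e (w : Word L) → StaysAbove d w → e + downs w L ≡ d + ups w L → endsAt (walk d w) e ≡ true
walk-complete d e [] _ balance =
  reflects-true (≡ᵇ-reflects-≡ d e) (trans (sym (+-identityʳ d)) (trans (sym balance) (+-identityʳ e)))
walk-complete {suc L} d e (fzero ∷ w) above balance = walk-complete (suc d) e w above′ balance′
  where
  above′ : StaysAbove (suc d) w
  above′ q q≤L = subst₂ _≤_ (downs-cons fzero w q)
    (trans (cong (d +_) (ups-cons fzero w q)) (+-suc d (ups w q))) (above (suc q) (s≤s q≤L))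
  balance′ : e + downs w L ≡ suc d + ups w L
  balance′ = trans (trans (cong (e +_) (sym (downs-cons fzero w L))) balance)
    (trans (cong (d +_) (ups-cons fzero w L)) (+-suc d (ups w L)))
walk-complete {suc L} zero e (fsuc x ∷ w) above balance =
  ⊥-elim (<⇒≱ (≤-reflexive (sym (downs-cons (fsuc x) w 0))) (≤-trans (above 1 (s≤s z≤n)) (≤-reflexive (ups-cons (fsuc x) w 0))))
walk-complete {suc L} (suc d) e (fsuc x ∷ w) above balance = walk-complete d e w above′ balance′
  where
  above′ : StaysAbove d w
  above′ q q≤L = ≤-pred (subst₂ _≤_ (downs-cons (fsuc x) w q) (cong (suc d +_) (ups-cons (fsuc x) w q)) (above (suc q) (s≤s q≤L)))
  balance′ : e + downs w L ≡ d + ups w L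
  balance′ = suc-injective (trans (sym (+-suc e (downs w L)))
    (trans (trans (cong (e +_) (sym (downs-cons (fsuc x) w L))) balance) (cong (suc d +_) (ups-cons (fsuc x) w L))))

walk-bounds : ∀ {L} d e (w : Word L) → endsAt (walk d w) e ≡ true → (e ≤ d + L) × (d ≤ e + L)
walk-bounds {L} d e w arrives =
  ≤-trans (m≤m+n e _) (≤-trans (≤-reflexive balance) (+-monoʳ-≤ d (ups≤length w))) ,
  ≤-trans (m≤m+n d _) (≤-trans (≤-reflexive (sym balance)) (+-monoʳ-≤ e (downs≤length w)))
  where balance = proj₂ (walk-sound d e w arrives)

∑-words-suc : ∀ L (F : Word (suc L) → ℕ) →
  ∑ (allVec (suc L) 2) F ≡ ∑ (allVec L 2) (λ w → F (fzero ∷ w)) + (∑ (allVec L 2) (λ w → F (fsuc fzero ∷ w)) + 0)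
∑-words-suc L F = trans (∑-concatMap (λ x → map (x ∷_) (allVec L 2)) (allFin 2) F)
  (cong₂ _+_ (∑-map _ (allVec L 2) F) (cong (_+ 0) (∑-map _ (allVec L 2) F)))

∑-words-++ : ∀ p L (F : Word (p + L) → ℕ) →
  ∑ (allVec (p + L) 2) F ≡ ∑ (allVec p 2) (λ u → ∑ (allVec L 2) (λ r → F (u ++ r)))
∑-words-++ zero L F = sym (+-identityʳ _)
∑-words-++ (suc p) L F = trans (∑-words-suc (p + L) F)
  (trans (cong₂ (λ a b → a + (b + 0)) (∑-words-++ p L (λ w → F (fzero ∷ w))) (∑-words-++ p L (λ w → F (fsuc fzero ∷ w))))
    (sym (∑-words-suc p (λ u → ∑ (allVec L 2) (λ r → F (u ++ r))))))

paths : ℕ → ℕ → ℕ → ℕ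
paths d e L = ∑ (allVec L 2) (λ w → 𝟙 (endsAt (walk d w) e))

paths-ground-suc : ∀ e L → paths 0 e (suc L) ≡ paths 1 e L
paths-ground-suc e L =
  trans (∑-words-suc L _) (trans (cong (λ x → paths 1 e L + (x + 0)) (∑-zero (allVec L 2) _ (λ _ → refl))) (+-identityʳ _))

paths-suc : ∀ d e L → paths (suc d) e (suc L) ≡ paths (suc (suc d)) e L + paths d e L
paths-suc d e L = trans (∑-words-suc L _) (cong (paths (suc (suc d)) e L +_) (+-identityʳ _))

paths-vanish : ∀ d e L → (d + L < e) ⊎ (e + L < d) → paths d e L ≡ 0
paths-vanish d e L tooFar = ∑-zero (allVec L 2) _ none
  where
  none : ∀ w → 𝟙 (endsAt (walk d w) e) ≡ 0
  none w with endsAt (walk d w) e in arrives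
  ... | false = refl
  ... | true = ⊥-elim (contradiction tooFar (walk-bounds d e w arrives))
    where
    contradiction : (d + L < e) ⊎ (e + L < d) → (e ≤ d + L) × (d ≤ e + L) → ⊥
    contradiction (inj₁ lt) (e≤ , _) = <⇒≱ lt e≤
    contradiction (inj₂ lt) (_ , d≤) = <⇒≱ lt d≤

paths-ballot : ∀ d u v e → e + v ≡ d + u → paths d e (u + v) ≡ ballot d u v
paths-ballot d zero zero e e≡d = cong (λ b → 𝟙 b + 0)
  (reflects-true (≡ᵇ-reflects-≡ d e) (sym (trans (sym (+-identityʳ e)) (trans e≡d (+-identityʳ d)))))
paths-ballot zero (suc u) zero e eq = trans (paths-ground-suc e (u + 0)) (paths-ballot 1 u zero e eq)
paths-ballot (suc d) (suc u) zero e eq = begin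
  paths (suc d) e (suc u + 0)                                ≡⟨ paths-suc d e (u + 0) ⟩
  paths (suc (suc d)) e (u + 0) + paths d e (u + 0)          ≡⟨ cong (paths (suc (suc d)) e (u + 0) +_) unreachable ⟩
  paths (suc (suc d)) e (u + 0) + 0                          ≡⟨ +-identityʳ _ ⟩
  paths (suc (suc d)) e (u + 0)                              ≡⟨ paths-ballot (suc (suc d)) u zero e (trans eq (cong suc (+-suc d u))) ⟩
  ballot (suc (suc d)) u zero ∎
  where
  open ≡-Reasoning
  unreachable : paths d e (u + 0) ≡ 0
  unreachable = paths-vanish d e (u + 0) (inj₁ (subst (d + (u + 0) <_) (sym (trans (sym (+-identityʳ e)) eq))
    (s≤s (+-monoʳ-≤ d (≤-trans (≤-reflexive (+-identityʳ u)) (n≤1+n u))))))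
paths-ballot zero zero (suc v) e eq = ⊥-elim (1+n≢0 (trans (sym (+-suc e v)) eq))
paths-ballot (suc d) zero (suc v) e eq = begin
  paths (suc d) e (suc v)                         ≡⟨ paths-suc d e v ⟩
  paths (suc (suc d)) e v + paths d e v           ≡⟨ cong (_+ paths d e v) unreachable ⟩
  paths d e v                                     ≡⟨ paths-ballot d zero v e (trans e+v≡d (sym (+-identityʳ d))) ⟩
  ballot d zero v ∎
  where
  open ≡-Reasoning
  e+v≡d : e + v ≡ d
  e+v≡d = suc-injective (trans (sym (+-suc e v)) (trans eq (cong suc (+-identityʳ d))))
  unreachable : paths (suc (suc d)) e v ≡ 0
  unreachable = paths-vanish (suc (suc d)) e v (inj₂ (subst (_< suc (suc d)) (sym e+v≡d) (≤-trans (n≤1+n _) (n<1+n (suc d)))))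
paths-ballot zero (suc u) (suc v) e eq = trans (paths-ground-suc e (u + suc v)) (paths-ballot 1 u (suc v) e eq)
paths-ballot (suc d) (suc u) (suc v) e eq = begin
  paths (suc d) e (suc u + suc v)                                  ≡⟨ paths-suc d e (u + suc v) ⟩
  paths (suc (suc d)) e (u + suc v) + paths d e (u + suc v)        ≡⟨ cong (λ L → paths (suc (suc d)) e (u + suc v) + paths d e L) (+-suc u v) ⟩
  paths (suc (suc d)) e (u + suc v) + paths d e (suc u + v)        ≡⟨ cong₂ _+_ (paths-ballot (suc (suc d)) u (suc v) e (trans eq (cong suc (+-suc d u))))
                                                                               (paths-ballot d (suc u) v e (suc-injective (trans (sym (+-suc e v)) eq))) ⟩
  ballot (suc (suc d)) u (suc v) + ballot d (suc u) v ∎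
  where open ≡-Reasoning

isDyck : ∀ {L} → Word L → Bool
isDyck w = endsAt (walk 0 w) 0

fewUps : ∀ {L} → ℕ → ℕ → Word L → Bool
fewUps c p w = ups w p ≤ᵇ c

upUpAfter downDownAfter : ∀ {L} → ℕ → ℕ → Word L → Bool
upUpAfter c p w = (ups w p ≡ᵇ c) ∧ (upAt w p ∧ upAt w (suc p))
downDownAfter c p w = (ups w p ≡ᵇ suc c) ∧ (not (upAt w p) ∧ not (upAt w (suc p)))

≤ᵇ-suc : ∀ m n → (suc m ≤ᵇ suc n) ≡ (m ≤ᵇ n)
≤ᵇ-suc zero n = refl
≤ᵇ-suc (suc m) n = refl

≤ᵇ-split : ∀ t c → 𝟙 (t ≤ᵇ c) ≡ 𝟙 (suc t ≤ᵇ c) + 𝟙 (t ≡ᵇ c)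
≤ᵇ-split zero zero = refl
≤ᵇ-split zero (suc c) = refl
≤ᵇ-split (suc t) zero = refl
≤ᵇ-split (suc t) (suc c) rewrite ≤ᵇ-suc t c | ≤ᵇ-suc (suc t) c = ≤ᵇ-split t c

-- Moving the cut two letters on: "at most c ↑ in the first p letters" turns into "at most c+1 ↑
-- in the first p+2", except that words with c + 1 ↑ followed by ↓↓ are gained and words with
-- c ↑ followed by ↑↑ are lost.
fewUps-step : ∀ t c a b → 𝟙 (t ≤ᵇ c) + 𝟙 ((t ≡ᵇ suc c) ∧ (not a ∧ not b)) ≡
  𝟙 (t + 𝟙 a + 𝟙 b ≤ᵇ suc c) + 𝟙 ((t ≡ᵇ c) ∧ (a ∧ b))
fewUps-step t c true true rewrite ∧-identityʳ (t ≡ᵇ c) | ∧-zeroʳ (t ≡ᵇ suc c) | +-comm (t + 1) 1 | +-comm t 1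
  | ≤ᵇ-suc (suc t) c = trans (+-identityʳ _) (≤ᵇ-split t c)
fewUps-step t c true false rewrite ∧-zeroʳ (t ≡ᵇ c) | ∧-zeroʳ (t ≡ᵇ suc c) | +-identityʳ (t + 1) | +-comm t 1
  | ≤ᵇ-suc t c = refl
fewUps-step t c false true rewrite ∧-zeroʳ (t ≡ᵇ c) | ∧-zeroʳ (t ≡ᵇ suc c) | +-identityʳ t | +-comm t 1
  | ≤ᵇ-suc t c = refl
fewUps-step t c false false rewrite ∧-zeroʳ (t ≡ᵇ c) | ∧-identityʳ (t ≡ᵇ suc c) | +-identityʳ t | +-identityʳ t
  | ≤ᵇ-split t (suc c) | ≤ᵇ-suc t c = sym (+-identityʳ _)

fewUps-exchange : ∀ {L} c p (w : Word L) →
  𝟙 (isDyck w ∧ fewUps c p w) + 𝟙 (isDyck w ∧ downDownAfter c p w) ≡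
  𝟙 (isDyck w ∧ fewUps (suc c) (suc (suc p)) w) + 𝟙 (isDyck w ∧ upUpAfter c p w)
fewUps-exchange c p w with isDyck w
... | false = refl
... | true = fewUps-step (ups w p) c (upAt w p) (upAt w (suc p))

UpsDetermineHeight : ℕ → ℕ → ℕ → Set
UpsDetermineHeight p c z = ∀ (u : Word p) e → walk 0 u ≡ just e → (ups u p ≡ c → e ≡ z) × (e ≡ z → ups u p ≡ c)

-- This is the case for p = c + k with c = k + z: then c ↑ force k ↓.
ups-determine-height : ∀ p c z k → p ≡ c + k → c ≡ k + z → UpsDetermineHeight p c z
ups-determine-height p c z k p≡c+k c≡k+z u e walked = toHeight , toUps
  where
  arrives : endsAt (walk 0 u) e ≡ true
  arrives = trans (cong (λ h → endsAt h e) walked) (reflects-true (≡ᵇ-reflects-≡ e e) refl)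
  balance : e + downs u p ≡ ups u p
  balance = proj₂ (walk-sound 0 e u arrives)
  total : ups u p + downs u p ≡ c + k
  total = trans (prefixCount-split (upAt u) p) p≡c+k
  toHeight : ups u p ≡ c → e ≡ z
  toHeight ups≡c = +-cancelʳ-≡ k e z (begin
    e + k          ≡⟨ cong (e +_) (sym downs≡k) ⟩
    e + downs u p  ≡⟨ balance ⟩
    ups u p        ≡⟨ trans ups≡c c≡k+z ⟩
    k + z          ≡⟨ +-comm k z ⟩
    z + k ∎)
    where
    open ≡-Reasoning
    downs≡k : downs u p ≡ k
    downs≡k = +-cancelˡ-≡ c (downs u p) k (trans (cong (_+ downs u p) (sym ups≡c)) total)
  toUps : e ≡ z → ups u p ≡ c
  toUps refl = begin
    ups u p        ≡⟨ sym balance ⟩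
    e + downs u p  ≡⟨ cong (e +_) downs≡k ⟩
    e + k          ≡⟨ +-comm e k ⟩
    k + e          ≡⟨ sym c≡k+z ⟩
    c ∎
    where
    open ≡-Reasoning
    -- ups = e + downs and ups + downs = k + e + k, so downs = k
    twice : downs u p + downs u p ≡ k + k
    twice = +-cancelʳ-≡ e _ _ (begin
      downs u p + downs u p + e     ≡⟨ +-comm (downs u p + downs u p) e ⟩
      e + (downs u p + downs u p)   ≡⟨ sym (+-assoc e _ _) ⟩
      e + downs u p + downs u p     ≡⟨ cong (_+ downs u p) balance ⟩
      ups u p + downs u p           ≡⟨ total ⟩
      c + k                         ≡⟨ cong (_+ k) (trans c≡k+z (+-comm k e)) ⟩
      e + k + k                     ≡⟨ +-assoc e k k ⟩
      e + (k + k)                   ≡⟨ +-comm e (k + k) ⟩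
      k + k + e ∎)
    downs≡k : downs u p ≡ k
    downs≡k = double-injective (downs u p) k twice

module _ {p M : ℕ} where

  split-indicator : ∀ c z → UpsDetermineHeight p c z → (u : Word p) (r : Word M) (X : Bool) →
    𝟙 (endsAt (walk 0 u >>= λ e → walk e r) 0 ∧ ((ups u p ≡ᵇ c) ∧ X)) ≡
    𝟙 (endsAt (walk 0 u) z) * 𝟙 (endsAt (walk z r) 0 ∧ X)
  split-indicator c z crit u r X with walk 0 u in walked
  ... | nothing = refl
  ... | just e with e ≡ᵇ z in atZ
  ...   | false rewrite reflects-false (≡ᵇ-reflects-≡ (ups u p) c)
                          (λ ups≡c → false≢true (trans (sym atZ) (reflects-true (≡ᵇ-reflects-≡ e z) (proj₁ (crit u e walked) ups≡c))))
          = cong 𝟙 (∧-zeroʳ _)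
  ...   | true with reflects-sound (≡ᵇ-reflects-≡ e z) atZ
  ...     | refl rewrite reflects-true (≡ᵇ-reflects-≡ (ups u p) c) (proj₂ (crit u e walked) refl) = sym (+-identityʳ _)

  upAt-boundary : (u : Word p) (r : Word M) → (upAt (u ++ r) p ≡ upAt r 0) × (upAt (u ++ r) (suc p) ≡ upAt r 1)
  upAt-boundary u r = trans (cong (upAt (u ++ r)) (sym (+-identityʳ p))) (upAt-++ʳ u r 0) ,
                      trans (cong (upAt (u ++ r)) (+-comm 1 p)) (upAt-++ʳ u r 1)

  upUp-indicator : ∀ c z → UpsDetermineHeight p c z → (u : Word p) (r : Word M) →
    𝟙 (isDyck (u ++ r) ∧ upUpAfter c p (u ++ r)) ≡ 𝟙 (endsAt (walk 0 u) z) * 𝟙 (endsAt (walk z r) 0 ∧ (upAt r 0 ∧ upAt r 1))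
  upUp-indicator c z crit u r rewrite walk-++ 0 u r | ups-++ u r | proj₁ (upAt-boundary u r) | proj₂ (upAt-boundary u r) =
    split-indicator c z crit u r _

  downDown-indicator : ∀ c z → UpsDetermineHeight p (suc c) z → (u : Word p) (r : Word M) →
    𝟙 (isDyck (u ++ r) ∧ downDownAfter c p (u ++ r)) ≡
    𝟙 (endsAt (walk 0 u) z) * 𝟙 (endsAt (walk z r) 0 ∧ (not (upAt r 0) ∧ not (upAt r 1)))
  downDown-indicator c z crit u r rewrite walk-++ 0 u r | ups-++ u r | proj₁ (upAt-boundary u r) | proj₂ (upAt-boundary u r) =
    split-indicator (suc c) z crit u r _

upUp-suffixes : ∀ d m → ∑ (allVec (suc (suc m)) 2) (λ r → 𝟙 (endsAt (walk d r) 0 ∧ (upAt r 0 ∧ upAt r 1))) ≡ paths (suc (suc d)) 0 m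
upUp-suffixes d m = begin
  _ ≡⟨ ∑-words-suc (suc m) _ ⟩
  ∑ (allVec (suc m) 2) (λ r → 𝟙 (endsAt (walk (suc d) r) 0 ∧ upAt r 0)) + (∑ (allVec (suc m) 2) (λ r → 𝟙 (endsAt (walk d (fsuc fzero ∷ r)) 0 ∧ false)) + 0)
    ≡⟨ cong₂ (λ a b → a + (b + 0)) (∑-words-suc m _) (∑-zero (allVec (suc m) 2) _ (λ r → cong 𝟙 (∧-zeroʳ _))) ⟩
  ∑ (allVec m 2) (λ v → 𝟙 (endsAt (walk (suc (suc d)) v) 0 ∧ true)) + (∑ (allVec m 2) (λ v → 𝟙 (endsAt (walk (suc d) (fsuc fzero ∷ v)) 0 ∧ false)) + 0) + 0
    ≡⟨ cong₂ (λ a b → a + (b + 0) + 0) (∑-cong (allVec m 2) (λ v → cong 𝟙 (∧-identityʳ _))) (∑-zero (allVec m 2) _ (λ v → cong 𝟙 (∧-zeroʳ _))) ⟩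
  paths (suc (suc d)) 0 m + 0 + 0 ≡⟨ trans (+-identityʳ _) (+-identityʳ _) ⟩
  paths (suc (suc d)) 0 m ∎
  where open ≡-Reasoning

downDown-suffixes : ∀ d m → ∑ (allVec (suc (suc m)) 2) (λ r → 𝟙 (endsAt (walk (suc (suc d)) r) 0 ∧ (not (upAt r 0) ∧ not (upAt r 1)))) ≡ paths d 0 m
downDown-suffixes d m = begin
  _ ≡⟨ ∑-words-suc (suc m) _ ⟩
  ∑ (allVec (suc m) 2) (λ r → 𝟙 (endsAt (walk (suc (suc (suc d))) r) 0 ∧ false)) + (∑ (allVec (suc m) 2) (λ r → 𝟙 (endsAt (walk (suc d) r) 0 ∧ not (upAt r 0))) + 0)
    ≡⟨ cong₂ (λ a b → a + (b + 0)) (∑-zero (allVec (suc m) 2) _ (λ r → cong 𝟙 (∧-zeroʳ _))) (∑-words-suc m _) ⟩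
  ∑ (allVec m 2) (λ v → 𝟙 (endsAt (walk (suc (suc d)) v) 0 ∧ false)) + (∑ (allVec m 2) (λ v → 𝟙 (endsAt (walk d v) 0 ∧ true)) + 0) + 0
    ≡⟨ cong₂ (λ a b → a + (b + 0) + 0) (∑-zero (allVec m 2) _ (λ v → cong 𝟙 (∧-zeroʳ _))) (∑-cong (allVec m 2) (λ v → cong 𝟙 (∧-identityʳ _))) ⟩
  paths d 0 m + 0 + 0 ≡⟨ trans (+-identityʳ _) (+-identityʳ _) ⟩
  paths d 0 m ∎
  where open ≡-Reasoning

count-upUp : ∀ p m c z → UpsDetermineHeight p c z →
  ∑ (allVec (p + suc (suc m)) 2) (λ w → 𝟙 (isDyck w ∧ upUpAfter c p w)) ≡ paths 0 z p * paths (suc (suc z)) 0 m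
count-upUp p m c z crit = begin
  _ ≡⟨ ∑-words-++ p (suc (suc m)) _ ⟩
  ∑ (allVec p 2) (λ u → ∑ (allVec (suc (suc m)) 2) (λ r → 𝟙 (isDyck (u ++ r) ∧ upUpAfter c p (u ++ r))))
    ≡⟨ ∑-cong (allVec p 2) (λ u → trans (∑-cong (allVec (suc (suc m)) 2) (upUp-indicator c z crit u))
         (trans (∑-*ˡ (allVec (suc (suc m)) 2) (𝟙 (endsAt (walk 0 u) z)) _) (cong (𝟙 (endsAt (walk 0 u) z) *_) (upUp-suffixes z m)))) ⟩
  ∑ (allVec p 2) (λ u → 𝟙 (endsAt (walk 0 u) z) * paths (suc (suc z)) 0 m) ≡⟨ ∑-*ʳ (allVec p 2) _ _ ⟩
  paths 0 z p * paths (suc (suc z)) 0 m ∎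
  where open ≡-Reasoning

count-downDown : ∀ p m c z → UpsDetermineHeight p (suc c) (suc (suc z)) →
  ∑ (allVec (p + suc (suc m)) 2) (λ w → 𝟙 (isDyck w ∧ downDownAfter c p w)) ≡ paths 0 (suc (suc z)) p * paths z 0 m
count-downDown p m c z crit = begin
  _ ≡⟨ ∑-words-++ p (suc (suc m)) _ ⟩
  ∑ (allVec p 2) (λ u → ∑ (allVec (suc (suc m)) 2) (λ r → 𝟙 (isDyck (u ++ r) ∧ downDownAfter c p (u ++ r))))
    ≡⟨ ∑-cong (allVec p 2) (λ u → trans (∑-cong (allVec (suc (suc m)) 2) (downDown-indicator c (suc (suc z)) crit u))
         (trans (∑-*ˡ (allVec (suc (suc m)) 2) (𝟙 (endsAt (walk 0 u) (suc (suc z)))) _) (cong (𝟙 (endsAt (walk 0 u) (suc (suc z))) *_) (downDown-suffixes z m)))) ⟩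
  ∑ (allVec p 2) (λ u → 𝟙 (endsAt (walk 0 u) (suc (suc z))) * paths z 0 m) ≡⟨ ∑-*ʳ (allVec p 2) _ _ ⟩
  paths 0 (suc (suc z)) p * paths z 0 m ∎
  where open ≡-Reasoning

-- The four ballot numbers of the comparison (h = k0 + z0 + 2, z = z0 + 1, n = h + t + 1):
-- prefixes of length 2k0+z0+2 from height 0 to z0 resp. z0 + 2, and suffixes of length
-- 2t+z0+2 from height z0 + 2 resp. z0 down to 0.
prefixUp prefixDown : ℕ → ℕ → ℕ
prefixUp k0 z0 = ballot 0 (suc k0 + z0) (suc k0)
prefixDown k0 z0 = ballot 0 (k0 + suc (suc z0)) k0

suffixUp suffixDown : ℕ → ℕ → ℕ
suffixUp z0 t = ballot (suc (suc z0)) t (t + suc (suc z0))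
suffixDown z0 t = ballot z0 (suc t) (suc t + z0)

cross-multiply : ∀ k0 z0 t P₁ P₂ S₁ S₂ β γ σ σ′ →
  suc (suc k0 + z0) * P₁ ≡ suc z0 * β → suc (k0 + suc (suc z0)) * P₂ ≡ suc (suc (suc z0)) * γ →
  suc (t + suc (suc z0)) * S₁ ≡ suc (suc (suc z0)) * σ → suc (suc t + z0) * S₂ ≡ suc z0 * σ′ →
  β * suc k0 ≡ γ * suc (suc k0 + z0) → σ′ * suc t ≡ σ * (t + suc (suc z0)) →
  (P₁ * S₁) * (suc k0 * (t + z0 + 3)) ≡ (P₂ * S₂) * (suc (k0 + z0 + 2) * suc t)
cross-multiply k0 z0 t P₁ P₂ S₁ S₂ β γ σ σ′ hP₁ hP₂ hS₁ hS₂ βγ σσ′ = *-cancelʳ-≡ _ _ (A * B) (begin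
  (P₁ * S₁) * (suc k0 * (t + z0 + 3)) * (A * B)            ≡⟨ r₁ P₁ S₁ k0 z0 t ⟩
  (A * P₁) * (suc (t + suc (suc z0)) * S₁) * suc k0 * B   ≡⟨ cong₂ (λ a b → a * b * suc k0 * B) hP₁ hS₁ ⟩
  (suc z0 * β) * (suc (suc (suc z0)) * σ) * suc k0 * B    ≡⟨ r₂ β σ z0 k0 B ⟩
  suc z0 * suc (suc (suc z0)) * (β * suc k0) * (σ * B)    ≡⟨ cong₂ (λ a b → suc z0 * suc (suc (suc z0)) * a * b) βγ (sym σσ′) ⟩
  suc z0 * suc (suc (suc z0)) * (γ * A) * (σ′ * suc t)    ≡⟨ r₃ γ σ′ z0 A t ⟩
  (suc (suc (suc z0)) * γ) * (suc z0 * σ′) * A * suc t    ≡⟨ cong₂ (λ a b → a * b * A * suc t) (sym hP₂) (sym hS₂) ⟩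
  (suc (k0 + suc (suc z0)) * P₂) * (suc (suc t + z0) * S₂) * A * suc t ≡⟨ r₄ P₂ S₂ k0 z0 t ⟩
  (P₂ * S₂) * (suc (k0 + z0 + 2) * suc t) * (A * B) ∎)
  where
  open ≡-Reasoning
  A B : ℕ
  A = suc (suc k0 + z0)
  B = t + suc (suc z0)
  instance
    B≢0 : NonZero B
    B≢0 = >-nonZero (≤-trans (s≤s z≤n) (m≤n+m (suc (suc z0)) t))
    AB≢0 : NonZero (A * B)
    AB≢0 = m*n≢0 A B
  r₁ : ∀ P₁ S₁ k0 z0 t → (P₁ * S₁) * (suc k0 * (t + z0 + 3)) * (suc (suc k0 + z0) * (t + suc (suc z0))) ≡
    (suc (suc k0 + z0) * P₁) * (suc (t + suc (suc z0)) * S₁) * suc k0 * (t + suc (suc z0))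
  r₁ = solve-∀
  r₂ : ∀ β σ z0 k0 B → (suc z0 * β) * (suc (suc (suc z0)) * σ) * suc k0 * B ≡ suc z0 * suc (suc (suc z0)) * (β * suc k0) * (σ * B)
  r₂ = solve-∀
  r₃ : ∀ γ σ′ z0 A t → suc z0 * suc (suc (suc z0)) * (γ * A) * (σ′ * suc t) ≡ (suc (suc (suc z0)) * γ) * (suc z0 * σ′) * A * suc t
  r₃ = solve-∀
  r₄ : ∀ P₂ S₂ k0 z0 t → (suc (k0 + suc (suc z0)) * P₂) * (suc (suc t + z0) * S₂) * suc (suc k0 + z0) * suc t ≡
    (P₂ * S₂) * (suc (k0 + z0 + 2) * suc t) * (suc (suc k0 + z0) * (t + suc (suc z0)))
  r₄ = solve-∀

ballot-products-ratio : ∀ k0 z0 t →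
  (prefixUp k0 z0 * suffixUp z0 t) * (suc k0 * (t + z0 + 3)) ≡ (prefixDown k0 z0 * suffixDown z0 t) * (suc (k0 + z0 + 2) * suc t)
ballot-products-ratio k0 z0 t = cross-multiply k0 z0 t (prefixUp k0 z0) (prefixDown k0 z0) (suffixUp z0 t) (suffixDown z0 t)
  (binom L (suc k0)) (binom L k0) (binom M t) (binom M (suc t))
  (ballot-from-ground (suc k0) z0)
  (subst (λ x → suc (k0 + suc (suc z0)) * prefixDown k0 z0 ≡ suc (suc (suc z0)) * binom x k0) L′≡L (ballot-from-ground k0 (suc (suc z0))))
  (ballot-to-ground t (suc (suc z0)))
  (subst (λ x → suc (suc t + z0) * suffixDown z0 t ≡ suc z0 * binom x (suc t)) M′≡M (ballot-to-ground (suc t) z0))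
  (subst (λ x → binom x (suc k0) * suc k0 ≡ binom x k0 * suc (suc k0 + z0)) L″≡L (binom-succ k0 (suc (suc k0 + z0))))
  (binom-succ t (t + suc (suc z0)))
  where
  L M : ℕ
  L = (suc k0 + z0) + suc k0
  M = t + (t + suc (suc z0))
  L′≡L : (k0 + suc (suc z0)) + k0 ≡ L
  L′≡L = shape k0 z0
    where
    shape : ∀ k0 z0 → (k0 + suc (suc z0)) + k0 ≡ (suc k0 + z0) + suc k0
    shape = solve-∀
  L″≡L : k0 + suc (suc k0 + z0) ≡ L
  L″≡L = shape k0 z0
    where
    shape : ∀ k0 z0 → k0 + suc (suc k0 + z0) ≡ (suc k0 + z0) + suc k0
    shape = solve-∀
  M′≡M : suc t + (suc t + z0) ≡ M
  M′≡M = shape t z0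
    where
    shape : ∀ t z0 → suc t + (suc t + z0) ≡ t + (t + suc (suc z0))
    shape = solve-∀

-- The weights of the cross-multiplied identity compare like k0 and t:
-- (k0+z0+3)(t+1) + (z0+2)·k0 = (k0+1)(t+z0+3) + (z0+2)·t.
weights-compare : ∀ k0 z0 t → (k0 ≤ t → suc k0 * (t + z0 + 3) ≤ suc (k0 + z0 + 2) * suc t) ×
                              (t < k0 → suc (k0 + z0 + 2) * suc t < suc k0 * (t + z0 + 3))
weights-compare k0 z0 t = smaller , larger
  where
  difference : suc (k0 + z0 + 2) * suc t + (z0 + 2) * k0 ≡ suc k0 * (t + z0 + 3) + (z0 + 2) * t
  difference = shape k0 z0 t
    where
    shape : ∀ k0 z0 t → suc (k0 + z0 + 2) * suc t + (z0 + 2) * k0 ≡ suc k0 * (t + z0 + 3) + (z0 + 2) * t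
    shape = solve-∀
  smaller : k0 ≤ t → suc k0 * (t + z0 + 3) ≤ suc (k0 + z0 + 2) * suc t
  smaller k0≤t = +-cancelʳ-≤ ((z0 + 2) * k0) _ _
    (≤-trans (+-monoʳ-≤ (suc k0 * (t + z0 + 3)) (*-monoʳ-≤ (z0 + 2) k0≤t)) (≤-reflexive (sym difference)))
  larger : t < k0 → suc (k0 + z0 + 2) * suc t < suc k0 * (t + z0 + 3)
  larger t<k0 = +-cancelʳ-< ((z0 + 2) * t) _ _
    (<-≤-trans (+-monoʳ-< (suc (k0 + z0 + 2) * suc t) (*-monoʳ-< (z0 + 2) {{z0+2≢0}} t<k0)) (≤-reflexive difference))
    where
    z0+2≢0 : NonZero (z0 + 2)
    z0+2≢0 = >-nonZero (≤-trans (s≤s z≤n) (m≤n+m 2 z0))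

cross-compare : ∀ X Y a b → 0 < X → 0 < b → X * a ≡ Y * b → (a ≤ b → Y ≤ X) × (b < a → X < Y)
cross-compare X Y a b 0<X 0<b Xa≡Yb = fewer , more
  where
  instance
    b≢0 : NonZero b
    b≢0 = >-nonZero 0<b
  fewer : a ≤ b → Y ≤ X
  fewer a≤b = *-cancelʳ-≤ Y X b (≤-trans (≤-reflexive (sym Xa≡Yb)) (*-monoʳ-≤ X a≤b))
  more : b < a → X < Y
  more b<a = *-cancelʳ-< b X Y (subst (X * b <_) Xa≡Yb (*-monoʳ-< X {{>-nonZero 0<X}} b<a))

positive-by-formula : ∀ a b c x → suc a * x ≡ suc b * c → 0 < c → 0 < x
positive-by-formula a b c zero eq 0<c = ⊥-elim (<-irrefl (trans (sym (*-zeroʳ (suc a))) eq) (<-≤-trans 0<c (m≤m+n c _)))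
positive-by-formula a b c (suc x) eq 0<c = s≤s z≤n

ballot-products-compare : ∀ k0 z0 t →
  (0 < prefixUp k0 z0 * suffixUp z0 t) ×
  ((prefixDown k0 z0 * suffixDown z0 t ≤ prefixUp k0 z0 * suffixUp z0 t) ⇔ (k0 ≤ t))
ballot-products-compare k0 z0 t = 0<X , mk⇔ toK fromK
  where
  X = prefixUp k0 z0 * suffixUp z0 t
  Y = prefixDown k0 z0 * suffixDown z0 t
  L = (suc k0 + z0) + suc k0
  M = t + (t + suc (suc z0))
  0<X : 0 < X
  0<X = *-mono-≤
    (positive-by-formula (suc k0 + z0) z0 (binom L (suc k0)) (prefixUp k0 z0) (ballot-from-ground (suc k0) z0) (binom-pos L (suc k0) (m≤n+m (suc k0) (suc k0 + z0))))
    (positive-by-formula (t + suc (suc z0)) (suc (suc z0)) (binom M t) (suffixUp z0 t) (ballot-to-ground t (suc (suc z0))) (binom-pos M t (m≤m+n t _)))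
  compared = cross-compare X Y _ _ 0<X (s≤s z≤n) (ballot-products-ratio k0 z0 t)
  fromK : k0 ≤ t → Y ≤ X
  fromK k0≤t = proj₁ compared (proj₁ (weights-compare k0 z0 t) k0≤t)
  toK : Y ≤ X → k0 ≤ t
  toK Y≤X = ≮⇒≥ (λ t<k0 → <⇒≱ (proj₂ compared (proj₂ (weights-compare k0 z0 t) t<k0)) Y≤X)

#dyck : ℕ → ℕ
#dyck N = ∑ (allVec N 2) (λ w → 𝟙 (isDyck w))

#dyckWith : ∀ N → (Word N → Bool) → ℕ
#dyckWith N E = ∑ (allVec N 2) (λ w → 𝟙 (isDyck w ∧ E w))

fewUps-balance : ∀ N c p → #dyckWith N (fewUps c p) + #dyckWith N (downDownAfter c p) ≡
  #dyckWith N (fewUps (suc c) (suc (suc p))) + #dyckWith N (upUpAfter c p)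
fewUps-balance N c p = begin
  #dyckWith N (fewUps c p) + #dyckWith N (downDownAfter c p)
    ≡⟨ sym (∑-+ (allVec N 2) _ _) ⟩
  ∑ (allVec N 2) (λ w → 𝟙 (isDyck w ∧ fewUps c p w) + 𝟙 (isDyck w ∧ downDownAfter c p w))
    ≡⟨ ∑-cong (allVec N 2) (fewUps-exchange c p) ⟩
  ∑ (allVec N 2) (λ w → 𝟙 (isDyck w ∧ fewUps (suc c) (suc (suc p)) w) + 𝟙 (isDyck w ∧ upUpAfter c p w))
    ≡⟨ ∑-+ (allVec N 2) _ _ ⟩
  #dyckWith N (fewUps (suc c) (suc (suc p))) + #dyckWith N (upUpAfter c p) ∎
  where open ≡-Reasoning

exchange-compare : ∀ a b x y → a + y ≡ b + x → (b ≤ a ⇔ y ≤ x)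
exchange-compare a b x y a+y≡b+x = mk⇔
  (λ b≤a → +-cancelˡ-≤ a y x (≤-trans (≤-reflexive a+y≡b+x) (+-monoˡ-≤ x b≤a)))
  (λ y≤x → +-cancelʳ-≤ x b a (≤-trans (≤-reflexive (sym a+y≡b+x)) (+-monoʳ-≤ a y≤x)))

-- The cut of the comparison, in terms of k0 = h − z − 1, z0 = z − 1 and t = n − h − 1:
-- at most c = h − 1 letters ↑ among the first p = 2h − z − 1, in Dyck words of length N = 2n.
cutUps cutLength : ℕ → ℕ → ℕ
cutUps k0 z0 = suc k0 + z0
cutLength k0 z0 = cutUps k0 z0 + suc k0

dyckLength : ℕ → ℕ → ℕ → ℕ
dyckLength k0 z0 t = cutLength k0 z0 + suc (suc (t + (t + suc (suc z0))))

module _ (k0 z0 t : ℕ) where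
  private
    c p m N : ℕ
    c = cutUps k0 z0
    p = cutLength k0 z0
    m = t + (t + suc (suc z0))
    N = dyckLength k0 z0 t

  count-crossing-up : #dyckWith N (upUpAfter c p) ≡ prefixUp k0 z0 * suffixUp z0 t
  count-crossing-up = trans (count-upUp p m c z0 (ups-determine-height p c z0 (suc k0) refl refl))
    (cong₂ _*_ (paths-ballot 0 c (suc k0) z0 (+-comm z0 (suc k0)))
               (paths-ballot (suc (suc z0)) t (t + suc (suc z0)) 0 (+-comm t (suc (suc z0)))))

  count-crossing-down : #dyckWith N (downDownAfter c p) ≡ prefixDown k0 z0 * suffixDown z0 t
  count-crossing-down = trans (count-downDown p m c z0 (ups-determine-height p (suc c) (suc (suc z0)) k0 p≡ c≡))
    (cong₂ _*_ (trans (cong (paths 0 (suc (suc z0))) (sym p≡′)) (paths-ballot 0 (k0 + suc (suc z0)) k0 (suc (suc z0)) (+-comm (suc (suc z0)) k0)))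
               (trans (cong (paths z0 0) (sym m≡)) (paths-ballot z0 (suc t) (suc t + z0) 0 (+-comm (suc t) z0))))
    where
    p≡ : p ≡ suc c + k0
    p≡ = shape k0 z0
      where
      shape : ∀ k0 z0 → (suc k0 + z0) + suc k0 ≡ suc (suc k0 + z0) + k0
      shape = solve-∀
    c≡ : suc c ≡ k0 + suc (suc z0)
    c≡ = shape k0 z0
      where
      shape : ∀ k0 z0 → suc (suc k0 + z0) ≡ k0 + suc (suc z0)
      shape = solve-∀
    p≡′ : (k0 + suc (suc z0)) + k0 ≡ p
    p≡′ = shape k0 z0
      where
      shape : ∀ k0 z0 → (k0 + suc (suc z0)) + k0 ≡ (suc k0 + z0) + suc k0
      shape = solve-∀
    m≡ : suc t + (suc t + z0) ≡ m
    m≡ = shape t z0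
      where
      shape : ∀ t z0 → suc t + (suc t + z0) ≡ t + (t + suc (suc z0))
      shape = solve-∀

  dyck-comparison : (0 < #dyck N) ×
    ((#dyckWith N (fewUps (suc c) (suc (suc p))) ≤ #dyckWith N (fewUps c p)) ⇔ (k0 ≤ t))
  dyck-comparison = dyck-exist , mk⇔
    (λ E₂≤E₁ → Equivalence.to products (subst₂ _≤_ count-crossing-down count-crossing-up (Equivalence.to exchange E₂≤E₁)))
    (λ k0≤t → Equivalence.from exchange (subst₂ _≤_ (sym count-crossing-down) (sym count-crossing-up) (Equivalence.from products k0≤t)))
    where
    exchange = exchange-compare _ _ _ _ (fewUps-balance N c p)
    products = proj₂ (ballot-products-compare k0 z0 t)
    dyck-exist : 0 < #dyck N
    dyck-exist = <-≤-trans (subst (0 <_) (sym count-crossing-up) (proj₁ (ballot-products-compare k0 z0 t)))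
      (∑-mono (allVec N 2) (λ w → 𝟙-∧ (isDyck w) (upUpAfter c p w)))

∧-true : ∀ {a b} → a ≡ true → b ≡ true → (a ∧ b) ≡ true
∧-true refl refl = refl

∧-true⁻ : ∀ {a b} → (a ∧ b) ≡ true → (a ≡ true) × (b ≡ true)
∧-true⁻ {true} b≡true = refl , b≡true

does-sound : ∀ {P : Set} (P? : Dec P) → does P? ≡ true → P
does-sound (yes p) _ = p

does-≡ : ∀ {P : Set} (P? : Dec P) (b : Bool) → (P → b ≡ true) → (b ≡ true → P) → does P? ≡ b
does-≡ (yes p) b sound complete = sym (sound p)
does-≡ (no ¬p) false sound complete = refl
does-≡ (no ¬p) true sound complete = ⊥-elim (¬p (complete refl))

<ᵇ-suc : ∀ x y → 𝟙 (x <ᵇ suc y) ≡ 𝟙 (x <ᵇ y) + 𝟙 (x ≡ᵇ y)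
<ᵇ-suc x y = trans (cong 𝟙 (≤ᵇ-suc x y)) (≤ᵇ-split x y)

count-below : ∀ n m → m ≤ n → ∑ (allFin n) (λ i → 𝟙 (toℕ i <ᵇ m)) ≡ m
count-below zero zero _ = refl
count-below (suc n) zero _ = trans (∑-map fsuc (allFin n) _) (∑-zero (allFin n) _ (λ i → refl))
count-below (suc n) (suc m) (s≤s m≤n) = cong suc (trans (∑-map fsuc (allFin n) _) (count-below n m m≤n))

strictly-increasing-order : ∀ {n} (X : Fin n → ℕ) → (∀ i j → toℕ i < toℕ j → X i < X j) →
  ∀ i j → (X i <ᵇ X j) ≡ (toℕ i <ᵇ toℕ j)
strictly-increasing-order X increasing i j with <-cmp (toℕ i) (toℕ j)
... | tri< i<j _ _ = trans (reflects-true (<ᵇ-reflects-< _ _) (increasing i j i<j)) (sym (reflects-true (<ᵇ-reflects-< _ _) i<j))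
... | tri≈ _ i≡j _ rewrite Fin.toℕ-injective i≡j =
  trans (reflects-false (<ᵇ-reflects-< (X j) (X j)) (<-irrefl refl)) (sym (reflects-false (<ᵇ-reflects-< (toℕ j) (toℕ j)) (<-irrefl refl)))
... | tri> _ _ j<i = trans (reflects-false (<ᵇ-reflects-< _ _) (<-asym (increasing j i j<i)))
  (sym (reflects-false (<ᵇ-reflects-< _ _) (<-asym j<i)))

clamp : ∀ {N} → Fin N → ℕ → Fin N
clamp {N} default x with x <? N
... | yes x<N = fromℕ< x<N
... | no _ = default

toℕ-clamp : ∀ {N} (default : Fin N) x → x < N → toℕ (clamp default x) ≡ x
toℕ-clamp {N} default x x<N with x <? N
... | yes x<N′ = Fin.toℕ-fromℕ< x<N′
... | no x≮N = ⊥-elim (x≮N x<N)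

clamp-toℕ : ∀ {N} (default : Fin N) (k : Fin N) → clamp default (toℕ k) ≡ k
clamp-toℕ default k = Fin.toℕ-injective (toℕ-clamp default (toℕ k) (Fin.toℕ<n k))

colℕ-lookup : ∀ {m n} (v : Vec (Fin m) n) j (j<n : j < n) → colℕ v (suc j) ≡ toℕ (lookup v (fromℕ< j<n))
colℕ-lookup (x ∷ v) zero _ = refl
colℕ-lookup (x ∷ v) (suc j) (s≤s j<n) = colℕ-lookup v j j<n

upAt-lookup : ∀ {L} (w : Word L) (k : Fin L) → upAt w (toℕ k) ≡ isUp (lookup w k)
upAt-lookup (x ∷ w) fzero = refl
upAt-lookup (x ∷ w) (fsuc k) = upAt-lookup w k

letter : Bool → Fin 2
letter true = fzero
letter false = fsuc fzero

isUp-letter : ∀ b → isUp (letter b) ≡ b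
isUp-letter true = refl
isUp-letter false = refl

letter-isUp : ∀ (x : Fin 2) → letter (isUp x) ≡ x
letter-isUp fzero = refl
letter-isUp (fsuc fzero) = refl

inRow : ∀ {n} → Vec (Fin (2 * n)) n → Fin (2 * n) → Bool
inRow a ℓ = does (Fin.any? (λ i → lookup a i Fin.≟ ℓ))

toWord : ∀ {n} → Labelling n → Word (2 * n)
toWord (a ∷ b ∷ []) = tabulate (λ ℓ → letter (inRow a ℓ))

toLabelling : ∀ {n} → Word (2 * n) → Labelling n
toLabelling {n} w = tabulate (λ j → clamp (j ↑ˡ (n + 0)) (position (upAt w) (toℕ j) (2 * n)))
                  ∷ tabulate (λ j → clamp (j ↑ˡ (n + 0)) (position (not ∘ upAt w) (toℕ j) (2 * n))) ∷ []

module FromLinearExtension {n : ℕ} (a b : Vec (Fin (2 * n)) n) (isLE : IsLinearExtension (a ∷ b ∷ [])) where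
  private
    N = 2 * n
    L : Labelling n
    L = a ∷ b ∷ []
    order = proj₁ isLE
    injective = proj₁ (proj₂ isLE)
    surjective = proj₂ (proj₂ isLE)

  A B : Fin n → ℕ
  A i = toℕ (lookup a i)
  B i = toℕ (lookup b i)

  A-mono : ∀ i j → toℕ i < toℕ j → A i < A j
  A-mono i j i<j = ≤∧≢⇒< (order row1 i row1 j z≤n (<⇒≤ i<j))
    (λ e → <-irrefl (cong toℕ (proj₂ (injective row1 i row1 j (Fin.toℕ-injective e)))) i<j)

  B-mono : ∀ i j → toℕ i < toℕ j → B i < B j
  B-mono i j i<j = ≤∧≢⇒< (order row2 i row2 j ≤-refl (<⇒≤ i<j))
    (λ e → <-irrefl (cong toℕ (proj₂ (injective row2 i row2 j (Fin.toℕ-injective e)))) i<j)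

  A<B : ∀ i → A i < B i
  A<B i = ≤∧≢⇒< (order row1 i row2 i z≤n ≤-refl) (λ e → row1≢row2 (proj₁ (injective row1 i row2 i (Fin.toℕ-injective e))))
    where
    row1≢row2 : row1 ≢ row2
    row1≢row2 ()

  rows-disjoint : ∀ i j → lookup a i ≢ lookup b j
  rows-disjoint i j e with proj₁ (injective row1 i row2 j e)
  ... | ()

  φ : ℕ → Bool
  φ = upAt (toWord L)

  φ-inRow : ∀ (ℓ : Fin N) → φ (toℕ ℓ) ≡ inRow a ℓ
  φ-inRow ℓ = trans (upAt-lookup (toWord L) ℓ) (trans (cong isUp (Vec.lookup∘tabulate _ ℓ)) (isUp-letter _))

  occurrences-A : ∀ (ℓ : Fin N) → ∑ (allFin n) (λ i → 𝟙 (A i ≡ᵇ toℕ ℓ)) ≡ 𝟙 (inRow a ℓ)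
  occurrences-A ℓ with Fin.any? (λ i → lookup a i Fin.≟ ℓ)
  ... | yes (i₀ , e) = ∑-unique Fin._≟_ (allFin n) (allFin-enumerates n) _ i₀ (reflects-true (≡ᵇ-reflects-≡ _ _) (cong toℕ e))
        (λ i h → proj₂ (injective row1 i row1 i₀ (trans (Fin.toℕ-injective (reflects-sound (≡ᵇ-reflects-≡ _ _) h)) (sym e))))
  ... | no ∉a = ∑-zero (allFin n) _ (λ i → cong 𝟙 (reflects-false (≡ᵇ-reflects-≡ _ _) (λ h → ∉a (i , Fin.toℕ-injective h))))

  occurrences-B : ∀ (ℓ : Fin N) → ∑ (allFin n) (λ i → 𝟙 (B i ≡ᵇ toℕ ℓ)) ≡ 𝟙 (not (inRow a ℓ))
  occurrences-B ℓ with Fin.any? (λ i → lookup a i Fin.≟ ℓ)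
  ... | yes (i₀ , e) = ∑-zero (allFin n) _
        (λ i → cong 𝟙 (reflects-false (≡ᵇ-reflects-≡ _ _) (λ h → rows-disjoint i₀ i (trans e (sym (Fin.toℕ-injective h))))))
  ... | no ∉a = inRow2 (surjective ℓ)
    where
    inRow2 : (∃ λ r → ∃ λ c → val L r c ≡ ℓ) → ∑ (allFin n) (λ i → 𝟙 (B i ≡ᵇ toℕ ℓ)) ≡ 1
    inRow2 (fzero , c , e) = ⊥-elim (∉a (c , e))
    inRow2 (fsuc fzero , c , e) = ∑-unique Fin._≟_ (allFin n) (allFin-enumerates n) _ c (reflects-true (≡ᵇ-reflects-≡ _ _) (cong toℕ e))
        (λ i h → proj₂ (injective row2 i row2 c (trans (Fin.toℕ-injective (reflects-sound (≡ᵇ-reflects-≡ _ _) h)) (sym e))))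

  below : (Fin n → ℕ) → ℕ → ℕ
  below X q = ∑ (allFin n) (λ i → 𝟙 (X i <ᵇ q))

  below-suc : ∀ (X : Fin n → ℕ) q → below X (suc q) ≡ below X q + ∑ (allFin n) (λ i → 𝟙 (X i ≡ᵇ q))
  below-suc X q = trans (∑-cong (allFin n) (λ i → <ᵇ-suc (X i) q)) (∑-+ (allFin n) _ _)

  ups≡below : ∀ q → q ≤ N → prefixCount φ q ≡ below A q
  ups≡below zero _ = sym (∑-zero (allFin n) _ (λ i → refl))
  ups≡below (suc q) q<N = trans (cong₂ _+_ (ups≡below q (<⇒≤ q<N)) atq) (sym (below-suc A q))
    where
    ℓ = fromℕ< q<N
    atq : 𝟙 (φ q) ≡ ∑ (allFin n) (λ i → 𝟙 (A i ≡ᵇ q))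
    atq = subst (λ x → 𝟙 (φ x) ≡ ∑ (allFin n) (λ i → 𝟙 (A i ≡ᵇ x))) (Fin.toℕ-fromℕ< q<N)
      (trans (cong 𝟙 (φ-inRow ℓ)) (sym (occurrences-A ℓ)))

  downs≡below : ∀ q → q ≤ N → prefixCount (not ∘ φ) q ≡ below B q
  downs≡below zero _ = sym (∑-zero (allFin n) _ (λ i → refl))
  downs≡below (suc q) q<N = trans (cong₂ _+_ (downs≡below q (<⇒≤ q<N)) atq) (sym (below-suc B q))
    where
    ℓ = fromℕ< q<N
    atq : 𝟙 (not (φ q)) ≡ ∑ (allFin n) (λ i → 𝟙 (B i ≡ᵇ q))
    atq = subst (λ x → 𝟙 (not (φ x)) ≡ ∑ (allFin n) (λ i → 𝟙 (B i ≡ᵇ x))) (Fin.toℕ-fromℕ< q<N)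
      (trans (cong (𝟙 ∘ not) (φ-inRow ℓ)) (sym (occurrences-B ℓ)))

  below-all : ∀ (X : Fin n → ℕ) → (∀ i → X i < N) → below X N ≡ n
  below-all X X<N = trans (∑-cong (allFin n) (λ i → trans (cong 𝟙 (reflects-true (<ᵇ-reflects-< _ _) (X<N i)))
    (sym (cong 𝟙 (reflects-true (<ᵇ-reflects-< _ _) (Fin.toℕ<n i)))))) (count-below n n ≤-refl)

  -- Since each column increases, no prefix has more ↓ than ↑: the word is a Dyck word.
  toWord-dyck : isDyck (toWord L) ≡ true
  toWord-dyck = walk-complete 0 0 (toWord L) above balance
    where
    above : StaysAbove 0 (toWord L)
    above q q≤N = subst₂ _≤_ (sym (downs≡below q q≤N)) (sym (ups≡below q q≤N)) (∑-mono (allFin n) column)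
      where
      column : ∀ i → 𝟙 (B i <ᵇ q) ≤ 𝟙 (A i <ᵇ q)
      column i with B i <ᵇ q in Bi<q
      ... | false = z≤n
      ... | true = ≤-reflexive (sym (cong 𝟙 (reflects-true (<ᵇ-reflects-< (A i) q)
              (<-trans (A<B i) (reflects-sound (<ᵇ-reflects-< (B i) q) Bi<q)))))
    balance : 0 + downs (toWord L) N ≡ 0 + ups (toWord L) N
    balance = trans (downs≡below N ≤-refl) (trans (below-all B (λ i → Fin.toℕ<n (lookup b i)))
      (sym (trans (ups≡below N ≤-refl) (below-all A (λ i → Fin.toℕ<n (lookup a i))))))

  position-A : ∀ j → position φ (toℕ j) N ≡ A j
  position-A j = position-unique φ (toℕ j) N (A j) (Fin.toℕ<n (lookup a j)) isRow1 count
    where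
    isRow1 : φ (A j) ≡ true
    isRow1 = trans (φ-inRow (lookup a j)) (dec-true (Fin.any? (λ i → lookup a i Fin.≟ lookup a j)) (j , refl))
    count : prefixCount φ (A j) ≡ toℕ j
    count = trans (ups≡below (A j) (<⇒≤ (Fin.toℕ<n (lookup a j))))
      (trans (∑-cong (allFin n) (λ i → cong 𝟙 (strictly-increasing-order A A-mono i j))) (count-below n (toℕ j) (<⇒≤ (Fin.toℕ<n j))))

  position-B : ∀ j → position (not ∘ φ) (toℕ j) N ≡ B j
  position-B j = position-unique (not ∘ φ) (toℕ j) N (B j) (Fin.toℕ<n (lookup b j)) isRow2 count
    where
    isRow2 : not (φ (B j)) ≡ true
    isRow2 = cong not (trans (φ-inRow (lookup b j))
      (dec-false (Fin.any? (λ i → lookup a i Fin.≟ lookup b j)) (λ { (i , e) → rows-disjoint i j e })))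
    count : prefixCount (not ∘ φ) (B j) ≡ toℕ j
    count = trans (downs≡below (B j) (<⇒≤ (Fin.toℕ<n (lookup b j))))
      (trans (∑-cong (allFin n) (λ i → cong 𝟙 (strictly-increasing-order B B-mono i j))) (count-below n (toℕ j) (<⇒≤ (Fin.toℕ<n j))))

  toLabelling-toWord : toLabelling (toWord L) ≡ L
  toLabelling-toWord = cong₂ (λ x y → x ∷ y ∷ []) (read a position-A) (read b position-B)
    where
    read : ∀ (r : Vec (Fin N) n) {ψ} → (∀ j → position ψ (toℕ j) N ≡ toℕ (lookup r j)) →
      tabulate (λ j → clamp (j ↑ˡ (n + 0)) (position ψ (toℕ j) N)) ≡ r
    read r places = trans (Vec.tabulate-cong (λ j → trans (cong (clamp (j ↑ˡ (n + 0))) (places j)) (clamp-toℕ _ (lookup r j))))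
      (Vec.tabulate∘lookup r)

module FromDyckWord {n : ℕ} (w : Word (2 * n)) (dyck : isDyck w ≡ true) where
  private
    N = 2 * n

  φ ψ : ℕ → Bool
  φ = upAt w
  ψ = not ∘ φ

  private
    walked = walk-sound 0 0 w dyck

  ups-total : prefixCount φ N ≡ n
  ups-total = double-injective (prefixCount φ N) n
    (trans (cong (prefixCount φ N +_) (sym (proj₂ walked))) (trans (prefixCount-split φ N) (cong (n +_) (+-identityʳ n))))

  downs-total : prefixCount ψ N ≡ n
  downs-total = trans (proj₂ walked) ups-total

  P Q : ℕ → ℕ
  P j = position φ j N
  Q j = position ψ j N

  P<N : ∀ {j} → j < n → P j < N
  P<N j<n = position<N φ _ N (subst (_ <_) (sym ups-total) j<n)

  Q<N : ∀ {j} → j < n → Q j < N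
  Q<N j<n = position<N ψ _ N (subst (_ <_) (sym downs-total) j<n)

  up-at-P : ∀ {j} → j < n → φ (P j) ≡ true
  up-at-P j<n = proj₂ (position-spec φ _ N (P<N j<n))

  down-at-Q : ∀ {j} → j < n → φ (Q j) ≡ false
  down-at-Q j<n = trans (sym (not-involutive _)) (cong not (proj₂ (position-spec ψ _ N (Q<N j<n))))

  -- Staying above 0 means the (j+1)-th ↑ comes before the (j+1)-th ↓.
  P<Q : ∀ {j} → j < n → P j < Q j
  P<Q {j} j<n = proj₂ (position-galois φ j N (Q j) (<⇒≤ (Q<N j<n))) j<ups
    where
    q = Q j
    spec = position-spec ψ j N (Q<N j<n)
    j<ups : j < prefixCount φ q
    j<ups = subst₂ _≤_ (trans (cong₂ _+_ (proj₁ spec) (cong 𝟙 (proj₂ spec))) (+-comm j 1))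
      (trans (cong (λ b → prefixCount φ q + 𝟙 b) (down-at-Q j<n)) (+-identityʳ _))
      (proj₁ walked (suc q) (Q<N j<n))

  upRow downRow : Vec (Fin N) n
  upRow = tabulate (λ j → clamp (j ↑ˡ (n + 0)) (P (toℕ j)))
  downRow = tabulate (λ j → clamp (j ↑ˡ (n + 0)) (Q (toℕ j)))

  upRow-entry : ∀ c → toℕ (lookup upRow c) ≡ P (toℕ c)
  upRow-entry c = trans (cong toℕ (Vec.lookup∘tabulate _ c)) (toℕ-clamp _ _ (P<N (Fin.toℕ<n c)))

  downRow-entry : ∀ c → toℕ (lookup downRow c) ≡ Q (toℕ c)
  downRow-entry c = trans (cong toℕ (Vec.lookup∘tabulate _ c)) (toℕ-clamp _ _ (Q<N (Fin.toℕ<n c)))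

  order-preserving : OrderPreserving (toLabelling {n} w)
  order-preserving fzero c fzero c′ _ c≤c′ =
    subst₂ _≤_ (sym (upRow-entry c)) (sym (upRow-entry c′)) (position-mono φ N c≤c′)
  order-preserving (fsuc fzero) c (fsuc fzero) c′ _ c≤c′ =
    subst₂ _≤_ (sym (downRow-entry c)) (sym (downRow-entry c′)) (position-mono ψ N c≤c′)
  order-preserving fzero c (fsuc fzero) c′ _ c≤c′ =
    subst₂ _≤_ (sym (upRow-entry c)) (sym (downRow-entry c′)) (≤-trans (position-mono φ N c≤c′) (<⇒≤ (P<Q (Fin.toℕ<n c′))))
  order-preserving (fsuc fzero) c fzero c′ () _

  rank-injective : ∀ χ → (∀ {j} → j < n → position χ j N < N) → ∀ (c c′ : Fin n) →
    position χ (toℕ c) N ≡ position χ (toℕ c′) N → c ≡ c′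
  rank-injective χ χ<N c c′ same with <-cmp (toℕ c) (toℕ c′)
  ... | tri< lt _ _ = ⊥-elim (<-irrefl same (position-strict χ N lt (χ<N (Fin.toℕ<n c′))))
  ... | tri≈ _ eq _ = Fin.toℕ-injective eq
  ... | tri> _ _ gt = ⊥-elim (<-irrefl (sym same) (position-strict χ N gt (χ<N (Fin.toℕ<n c))))

  P≢Q : ∀ c c′ → P (toℕ c) ≢ Q (toℕ c′)
  P≢Q c c′ e = false≢true (trans (sym (down-at-Q (Fin.toℕ<n c′))) (trans (cong φ (sym e)) (up-at-P (Fin.toℕ<n c))))

  injective : Injective (toLabelling {n} w)
  injective fzero c fzero c′ e =
    refl , rank-injective φ P<N c c′ (trans (sym (upRow-entry c)) (trans (cong toℕ e) (upRow-entry c′)))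
  injective (fsuc fzero) c (fsuc fzero) c′ e =
    refl , rank-injective ψ Q<N c c′ (trans (sym (downRow-entry c)) (trans (cong toℕ e) (downRow-entry c′)))
  injective fzero c (fsuc fzero) c′ e = ⊥-elim (P≢Q c c′ (trans (sym (upRow-entry c)) (trans (cong toℕ e) (downRow-entry c′))))
  injective (fsuc fzero) c fzero c′ e = ⊥-elim (P≢Q c′ c (sym (trans (sym (downRow-entry c)) (trans (cong toℕ e) (upRow-entry c′)))))

  in-upRow : (k : Fin N) → φ (toℕ k) ≡ true → ∃ λ c → lookup upRow c ≡ k
  in-upRow k up = fromℕ< j<n , Fin.toℕ-injective (trans (upRow-entry _) (trans (cong P (Fin.toℕ-fromℕ< j<n)) Pj))
    where
    j = prefixCount φ (toℕ k)
    j<n : j < n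
    j<n = subst (suc j ≤_) ups-total (≤-trans (≤-reflexive (trans (+-comm 1 j) (cong (λ b → j + 𝟙 b) (sym up))))
      (prefixCount-mono φ (Fin.toℕ<n k)))
    Pj : P j ≡ toℕ k
    Pj = position-unique φ j N (toℕ k) (Fin.toℕ<n k) up refl

  in-downRow : (k : Fin N) → φ (toℕ k) ≡ false → ∃ λ c → lookup downRow c ≡ k
  in-downRow k down = fromℕ< j<n , Fin.toℕ-injective (trans (downRow-entry _) (trans (cong Q (Fin.toℕ-fromℕ< j<n)) Qj))
    where
    notUp : ψ (toℕ k) ≡ true
    notUp = cong not down
    j = prefixCount ψ (toℕ k)
    j<n : j < n
    j<n = subst (suc j ≤_) downs-total (≤-trans (≤-reflexive (trans (+-comm 1 j) (cong (λ b → j + 𝟙 b) (sym notUp))))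
      (prefixCount-mono ψ (Fin.toℕ<n k)))
    Qj : Q j ≡ toℕ k
    Qj = position-unique ψ j N (toℕ k) (Fin.toℕ<n k) notUp refl

  surjective : Surjective (toLabelling {n} w)
  surjective k with φ (toℕ k) in letterOfk
  ... | true = fzero , in-upRow k letterOfk
  ... | false = fsuc fzero , in-downRow k letterOfk

  isLinearExtension : IsLinearExtension (toLabelling {n} w)
  isLinearExtension = order-preserving , injective , surjective

  inRow-upRow : ∀ (k : Fin N) → inRow upRow k ≡ φ (toℕ k)
  inRow-upRow k with φ (toℕ k) in letterOfk
  ... | true = dec-true (Fin.any? (λ i → lookup upRow i Fin.≟ k)) (in-upRow k letterOfk)
  ... | false = dec-false (Fin.any? (λ i → lookup upRow i Fin.≟ k)) λ { (i , e) → false≢true (trans (sym letterOfk)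
          (trans (cong φ (trans (sym (cong toℕ e)) (upRow-entry i))) (up-at-P (Fin.toℕ<n i)))) }

  toWord-toLabelling : toWord (toLabelling {n} w) ≡ w
  toWord-toLabelling = trans (Vec.tabulate-cong (λ k → trans (cong letter (trans (inRow-upRow k) (upAt-lookup w k)))
    (letter-isUp (lookup w k)))) (Vec.tabulate∘lookup w)

  down-before-up : ∀ c k → c + suc k ≤ N → (Q k < P c ⇔ prefixCount φ (c + suc k) ≤ c)
  down-before-up c k p≤N = mk⇔ toFew fromFew
    where
    p = c + suc k
    split : prefixCount φ p + prefixCount ψ p ≡ p
    split = prefixCount-split φ p
    fromFew : prefixCount φ p ≤ c → Q k < P c
    fromFew few = <-≤-trans Q<p p≤P
      where
      manyDowns : k < prefixCount ψ p
      manyDowns = ≰⇒> (λ downs≤k → <-irrefl refl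
        (≤-trans (s≤s (≤-trans (≤-reflexive (sym split)) (+-mono-≤ few downs≤k))) (≤-reflexive (sym (+-suc c k)))))
      Q<p : Q k < p
      Q<p = proj₂ (position-galois ψ k N p p≤N) manyDowns
      p≤P : p ≤ P c
      p≤P = ≮⇒≥ (λ P<p → <⇒≱ (proj₁ (position-galois φ c N p p≤N) P<p) few)
    toFew : Q k < P c → prefixCount φ p ≤ c
    toFew Q<P = ≮⇒≥ tooMany
      where
      tooMany : c < prefixCount φ p → ⊥
      tooMany c<ups = <-irrefl refl (≤-trans (+-mono-≤ c<ups k<downs) (≤-reflexive split))
        where
        k<downs : k < prefixCount ψ p
        k<downs = proj₁ (position-galois ψ k N p p≤N) (<-trans Q<P (proj₂ (position-galois φ c N p p≤N) c<ups))

event-toLabelling : ∀ {n} (w : Word (2 * n)) → isDyck w ≡ true → ∀ z c k → suc c ∸ z ≡ suc k →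
  c < n → k < n → c + suc k ≤ 2 * n → does (event? n (suc c) z (toLabelling {n} w)) ≡ fewUps c (c + suc k) w
event-toLabelling {n} w dyck z c k h-z≡ c<n k<n p≤N = does-≡ (event? n (suc c) z (toLabelling {n} w)) _
  (λ event → reflects-true (≤ᵇ-reflects-≤ _ _) (Equivalence.to (down-before-up c k p≤N) (subst₂ _<_ row2-entry row1-entry event)))
  (λ few → subst₂ _<_ (sym row2-entry) (sym row1-entry) (Equivalence.from (down-before-up c k p≤N) (reflects-sound (≤ᵇ-reflects-≤ _ _) few)))
  where
  open FromDyckWord {n} w dyck
  row2-entry : colℕ downRow (suc c ∸ z) ≡ Q k
  row2-entry = trans (cong (colℕ downRow) h-z≡) (trans (colℕ-lookup downRow k k<n) (trans (downRow-entry _) (cong Q (Fin.toℕ-fromℕ< k<n))))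
  row1-entry : colℕ upRow (suc c) ≡ P c
  row1-entry = trans (colℕ-lookup upRow c c<n) (trans (upRow-entry _) (cong P (Fin.toℕ-fromℕ< c<n)))

count-linear-extensions : ∀ n (E : Labelling n → Bool) (E′ : Word (2 * n) → Bool) →
  (∀ w → isDyck w ≡ true → E (toLabelling {n} w) ≡ E′ w) →
  ∑ (allLabellings n) (λ L → 𝟙 (does (isLinearExtension? L) ∧ E L)) ≡ #dyckWith (2 * n) E′
count-linear-extensions n E E′ E≡E′ =
  count-bijection _≟ᴸ_ _≟ᵛ_ (allLabellings n) (allVec (2 * n) 2) (allLabellings-enumerate n) (allVec-enumerates (2 * n) 2)
    (λ L → does (isLinearExtension? L) ∧ E L) (λ w → isDyck w ∧ E′ w) toWord toLabelling toDyck toExtension back forth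
  where
  extension : ∀ a b → (does (isLinearExtension? (a ∷ b ∷ [])) ∧ E (a ∷ b ∷ [])) ≡ true → IsLinearExtension (a ∷ b ∷ [])
  extension a b holds = does-sound (isLinearExtension? (a ∷ b ∷ [])) (proj₁ (∧-true⁻ holds))
  toDyck : ∀ L → (does (isLinearExtension? L) ∧ E L) ≡ true → (isDyck (toWord L) ∧ E′ (toWord L)) ≡ true
  toDyck (a ∷ b ∷ []) holds = ∧-true dyck (trans (sym (E≡E′ _ dyck)) (trans (cong E (toLabelling-toWord)) (proj₂ (∧-true⁻ holds))))
    where
    open FromLinearExtension a b (extension a b holds)
    dyck = toWord-dyck
  toExtension : ∀ w → (isDyck w ∧ E′ w) ≡ true → (does (isLinearExtension? (toLabelling {n} w)) ∧ E (toLabelling {n} w)) ≡ true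
  toExtension w holds = ∧-true (dec-true (isLinearExtension? (toLabelling {n} w)) (FromDyckWord.isLinearExtension {n} w dyck))
    (trans (E≡E′ w dyck) (proj₂ (∧-true⁻ holds)))
    where dyck = proj₁ (∧-true⁻ holds)
  back : ∀ L → (does (isLinearExtension? L) ∧ E L) ≡ true → toLabelling (toWord L) ≡ L
  back (a ∷ b ∷ []) holds = FromLinearExtension.toLabelling-toWord a b (extension a b holds)
  forth : ∀ w → (isDyck w ∧ E′ w) ≡ true → toWord (toLabelling {n} w) ≡ w
  forth w holds = FromDyckWord.toWord-toLabelling {n} w (proj₁ (∧-true⁻ holds))

#linearExtensions : ∀ n → length (linearExtensions n) ≡ #dyck (2 * n)
#linearExtensions n = begin
  length (linearExtensions n)
    ≡⟨ length-filter isLinearExtension? (allLabellings n) ⟩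
  ∑ (allLabellings n) (λ L → 𝟙 (does (isLinearExtension? L)))
    ≡⟨ ∑-cong (allLabellings n) (λ L → cong 𝟙 (sym (∧-identityʳ _))) ⟩
  ∑ (allLabellings n) (λ L → 𝟙 (does (isLinearExtension? L) ∧ true))
    ≡⟨ count-linear-extensions n (λ _ → true) (λ _ → true) (λ _ _ → refl) ⟩
  #dyckWith (2 * n) (λ _ → true)
    ≡⟨ ∑-cong (allVec (2 * n) 2) (λ w → cong 𝟙 (∧-identityʳ _)) ⟩
  #dyck (2 * n) ∎
  where open ≡-Reasoning

#linearExtensionsWith : ∀ n {p} {P : Pred (Labelling n) p} (P? : Decidable P) (E′ : Word (2 * n) → Bool) →
  (∀ w → isDyck w ≡ true → does (P? (toLabelling {n} w)) ≡ E′ w) →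
  length (filter P? (linearExtensions n)) ≡ #dyckWith (2 * n) E′
#linearExtensionsWith n P? E′ P≡E′ =
  trans (length-filter² isLinearExtension? P? (allLabellings n)) (count-linear-extensions n (does ∘ P?) E′ P≡E′)

ratio-mono : ∀ a b D → 0 < D → (ratio a D ≤ℚ ratio b D) ⇔ (a ≤ b)
ratio-mono a b (suc d) _ = mk⇔ numerators fractions
  where
  u = mkℚᵘ (ℤ.+ a) d
  v = mkℚᵘ (ℤ.+ b) d
  numerators : ratio a (suc d) ≤ℚ ratio b (suc d) → a ≤ b
  numerators a/D≤b/D with ℚᵘ.≤-respʳ-≃ (ℚ.toℚᵘ-fromℚᵘ v) (ℚᵘ.≤-respˡ-≃ (ℚ.toℚᵘ-fromℚᵘ u) (ℚ.toℚᵘ-mono-≤ a/D≤b/D))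
  ... | *≤* cross = *-cancelʳ-≤ a b (suc d)
    (ℤ.drop‿+≤+ (subst₂ ℤ._≤_ (sym (ℤ.pos-* a (suc d))) (sym (ℤ.pos-* b (suc d))) cross))
  fractions : a ≤ b → ratio a (suc d) ≤ℚ ratio b (suc d)
  fractions a≤b = ℚ.toℚᵘ-cancel-≤ (ℚᵘ.≤-respʳ-≃ (ℚᵘ.≃-sym (ℚ.toℚᵘ-fromℚᵘ v)) (ℚᵘ.≤-respˡ-≃ (ℚᵘ.≃-sym (ℚ.toℚᵘ-fromℚᵘ u))
    (*≤* (subst₂ ℤ._≤_ (ℤ.pos-* a (suc d)) (ℤ.pos-* b (suc d)) (ℤ.+≤+ (*-monoˡ-≤ (suc d) a≤b))))))

≤-cong-⇔ : ∀ {a b a′ b′} → a ≡ a′ → b ≡ b′ → (a ≤ b) ⇔ (a′ ≤ b′)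
≤-cong-⇔ refl refl = mk⇔ (λ x → x) (λ x → x)

-- The theorem for h = k0 + z0 + 2, z = z0 + 1 and n = h + t + 1, through the bijection with Dyck
-- words of length 2n: the events for h and h + 1 become fewUps c p and fewUps (c + 1) (p + 2).
-- (n stays a variable, so that the counts of linear extensions are never unfolded.)
module _ (k0 z0 t n : ℕ) (n≡h+1+t : n ≡ suc (suc (cutUps k0 z0)) + t) where
  private
    c p h z N : ℕ
    c = cutUps k0 z0
    p = cutLength k0 z0
    h = suc c
    z = suc z0
    N = dyckLength k0 z0 t

    2n≡N : 2 * n ≡ N
    2n≡N = trans (cong (2 *_) n≡h+1+t) (shape k0 z0 t)
      where
      shape : ∀ k0 z0 t → 2 * (suc (suc (suc k0 + z0)) + t) ≡ ((suc k0 + z0) + suc k0) + suc (suc (t + (t + suc (suc z0))))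
      shape = solve-∀

    p+2≤2n : suc (suc p) ≤ 2 * n
    p+2≤2n = subst (suc (suc p) ≤_) (sym 2n≡N) (subst (_≤ N) (+-comm p 2) (+-monoʳ-≤ p (s≤s (s≤s z≤n))))

    h<n : h < n
    h<n = subst (h <_) (sym n≡h+1+t) (m≤m+n (suc h) t)

    c<n : c < n
    c<n = <-trans (n<1+n c) h<n

    onN : ∀ (E : ∀ {L} → Word L → Bool) → #dyckWith (2 * n) E ≡ #dyckWith N E
    onN E = cong (λ L → #dyckWith L E) 2n≡N

    count-all : length (linearExtensions n) ≡ #dyck N
    count-all = trans (#linearExtensions n) (cong #dyck 2n≡N)

    count-h : length (filter (event? n h z) (linearExtensions n)) ≡ #dyckWith N (fewUps c p)
    count-h = trans (#linearExtensionsWith n (event? n h z) (fewUps c p)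
      (λ w dyck → event-toLabelling w dyck z c k0 (m+n∸n≡m (suc k0) z0) c<n
        (<-trans (s≤s (m≤m+n k0 z0)) c<n) (≤-trans (n≤1+n p) (<⇒≤ p+2≤2n))))
      (onN (fewUps c p))

    count-h+1 : length (filter (event? n (suc h) z) (linearExtensions n)) ≡ #dyckWith N (fewUps h (suc (suc p)))
    count-h+1 = trans (#linearExtensionsWith n (event? n (suc h) z) (fewUps h (suc (suc p)))
      (λ w dyck → trans (event-toLabelling w dyck z h (suc k0) (m+n∸n≡m (suc (suc k0)) z0) h<n
          (<-trans (s≤s (s≤s (m≤m+n k0 z0))) h<n) p′≤2n)
        (cong (λ q → fewUps h q w) p′≡p+2)))
      (onN (fewUps h (suc (suc p))))
      where
      p′≡p+2 : h + suc (suc k0) ≡ suc (suc p)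
      p′≡p+2 = cong suc (+-suc c (suc k0))
      p′≤2n : h + suc (suc k0) ≤ 2 * n
      p′≤2n = subst (_≤ 2 * n) (sym p′≡p+2) p+2≤2n

  R-comparison : (R n (suc (suc (cutUps k0 z0))) (suc z0) ≤ℚ R n (suc (cutUps k0 z0)) (suc z0)) ⇔ (k0 ≤ t)
  R-comparison = proj₂ (dyck-comparison k0 z0 t)
    ⇔-∘ (≤-cong-⇔ count-h+1 count-h
    ⇔-∘ ratio-mono (length (filter (event? n (suc h) z) (linearExtensions n))) (length (filter (event? n h z) (linearExtensions n)))
          (length (linearExtensions n)) (subst (0 <_) (sym count-all) (proj₁ (dyck-comparison k0 z0 t))))

theorem-parameters : ∀ n h z → h ≤ n ∸ 1 → 1 ≤ z → z ≤ h ∸ 1 →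
  ∃ λ k0 → ∃ λ z0 → ∃ λ t → (h ≡ suc (cutUps k0 z0)) × (z ≡ suc z0) × (n ≡ suc h + t)
theorem-parameters (suc n) (suc h) (suc z0) h≤n _ z≤h
  with m≤n⇒∃[o]m+o≡n z≤h | m≤n⇒∃[o]m+o≡n h≤n
... | k0 , z+k0≡h | t , h+t≡n = k0 , z0 , t , cong suc (trans (sym z+k0≡h) (cong suc (+-comm z0 k0))) , refl , cong suc (sym h+t≡n)

theorem-condition : ∀ k0 z0 t → (k0 ≤ t) ⇔ (2 * suc (cutUps k0 z0) ≤ (suc (suc (cutUps k0 z0)) + t) + suc z0)
theorem-condition k0 z0 t = mk⇔
  (λ k0≤t → subst₂ _≤_ (sym (lhs k0 z0)) (sym (rhs k0 z0 t)) (+-monoˡ-≤ (k0 + 2 * z0 + 4) k0≤t))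
  (λ 2h≤n+z → +-cancelʳ-≤ (k0 + 2 * z0 + 4) k0 t (subst₂ _≤_ (lhs k0 z0) (rhs k0 z0 t) 2h≤n+z))
  where
  lhs : ∀ k0 z0 → 2 * suc (suc k0 + z0) ≡ k0 + (k0 + 2 * z0 + 4)
  lhs = solve-∀
  rhs : ∀ k0 z0 t → suc (suc (suc k0 + z0)) + t + suc z0 ≡ t + (k0 + 2 * z0 + 4)
  rhs = solve-∀

reparametrised : ∀ n h z → (∃ λ k0 → ∃ λ z0 → ∃ λ t → (h ≡ suc (cutUps k0 z0)) × (z ≡ suc z0) × (n ≡ suc h + t)) →
  (R n (suc h) z ≤ℚ R n h z) ⇔ (2 * h ≤ n + z)
reparametrised n _ _ (k0 , z0 , t , refl , refl , n≡h+1+t) =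
  subst (λ m → (k0 ≤ t) ⇔ (2 * suc (cutUps k0 z0) ≤ m + suc z0)) (sym n≡h+1+t) (theorem-condition k0 z0 t)
  ⇔-∘ R-comparison k0 z0 t n n≡h+1+t

lemma4p3 : (n h z : ℕ) → 2 ≤ n → 1 ≤ h → h ≤ n ∸ 1 → 1 ≤ z → z ≤ h ∸ 1 →
    (R n (suc h) z ≤ℚ R n h z) ⇔ (2 * h ≤ n + z)
lemma4p3 n h z _ _ h≤n-1 1≤z z≤h-1 = reparametrised n h z (theorem-parameters n h z h≤n-1 1≤z z≤h-1)
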